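{- Let $p$ be a prime and let $G$ be a finite abelian $p$-group with $|G|>1$, say $G\cong \mathbb Z_{p^{k_1}}\oplus\cdots\oplus\mathbb Z_{p^{k_r}}$ with $1\le k_1\le\cdots\le k_r$, so that $\exp(G)=p^{k_r}$. Put $\mathsf d^*(G)=\sum_{t=1}^r(p^{k_t}-1)$. Let $A$ be a nonempty subset of $\{1,2,\ldots,p^{k_r}-1\}$ containing no multiple of $p$, and suppose any two distinct elements of $A$ are incongruent modulo $p$. Then, for each positive integer $k$, every sequence of elements of $G$ of length at least $p^k-1+\lceil(\mathsf d^*(G)+1)/|A|\rceil$ contains a nonempty $A$-weighted zero-sum subsequence whose length is divisible by $p^k$. Consequently, if $|A|\,(\exp(G)-1)\ge \mathsf d^*(G)=\mathsf D(G)-1$ (which holds in particular if $|A|\ge r$), then $$\mathsf s_A(G)\le \exp(G)-1+\left\lceil\frac{\mathsf D(G)}{|A|}\right\rceil.$$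
   Context: A sequence over $G$ is a finite (unordered) list $c_1,\ldots,c_m$ of elements of $G$, repetitions allowed; a subsequence is a sublist, and its length is its number of terms. For a set $A$ of integers, a sequence $c_1,\ldots,c_n$ is an $A$-weighted zero-sum sequence if there exist $a_1,\ldots,a_n\in A$ with $\sum_{i=1}^n a_ic_i=0$. $\mathsf s_A(G)$ is the least integer $m$ such that every sequence over $G$ of length at least $m$ has an $A$-weighted zero-sum subsequence of length $\exp(G)$. $\mathsf D(G)$ denotes the Davenport constant of $G$ (least $m$ such that every sequence of length $\ge m$ has a nonempty subsequence with sum $0$); for the $p$-group $G$ above it equals $\mathsf d^*(G)+1$. -}

module Defs where

open import Data.Nat using (ℕ; zero; suc; _+_; _*_; _∸_; _^_; _≤_; _<_)
open import Data.Nat.DivMod using (_/_)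
open import Data.Nat.Divisibility using (_∣_)
open import Data.Fin using (Fin)
import Data.Fin as F
open import Relation.Binary.PropositionalEquality using (_≡_)
open import Data.Fin.Subset using (Subset; _∈_; ∣_∣)
open import Data.Vec using (lookup)
open import Data.Bool using (if_then_else_)
open import Data.List using (List)
import Data.List.Membership.Propositional as LM
open import Data.Product using (Σ; _×_)

∑ : (m : ℕ) → (Fin m → ℕ) → ℕ
∑ zero    f = 0
∑ (suc m) f = f F.zero + ∑ m (λ i → f (F.suc i))

-- Ceiling division ⌈ a / b ⌉ (for b ≥ 1; value 0 when b = 0, never used).
ceilDiv : ℕ → ℕ → ℕ
ceilDiv a zero    = 0
ceilDiv a (suc b) = (a + b) / suc b

-- The group G = Z_{p^{ks 0}} ⊕ ... ⊕ Z_{p^{ks (r-1)}}: an element is represented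
-- by a vector of natural-number representatives, one per cyclic summand.
Elem : ℕ → Set
Elem r = Fin r → ℕ

IsZeroG : (p r : ℕ) → (ks : Fin r → ℕ) → Elem r → Set
IsZeroG p r ks x = (t : Fin r) → p ^ ks t ∣ x t

dStar : (p r : ℕ) → (Fin r → ℕ) → ℕ
dStar p r ks = ∑ r (λ t → p ^ ks t ∸ 1)

wsum : (r m : ℕ) → Subset m → (Fin m → ℕ) → (Fin m → Elem r) → Elem r
wsum r m S w c t = ∑ m (λ i → if lookup S i then w i * c i t else 0)

AWeightedZeroSum : (p r : ℕ) (ks : Fin r → ℕ) (A : List ℕ) (m : ℕ)
                   → (Fin m → Elem r) → Subset m → Set
AWeightedZeroSum p r ks A m c S =
  Σ (Fin m → ℕ) λ w → ((i : Fin m) → i ∈ S → w i LM.∈ A)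
                    × IsZeroG p r ks (wsum r m S w c)

-- "s_A(G) ≤ L": every sequence over G of length at least L has an A-weighted
-- zero-sum subsequence of length e = exp(G).
sA≤ : (p r : ℕ) (ks : Fin r → ℕ) (A : List ℕ) (e L : ℕ) → Set
sA≤ p r ks A e L =
  (m : ℕ) → L ≤ m → (c : Fin m → Elem r) →
  Σ (Subset m) λ S → (∣ S ∣ ≡ e) × AWeightedZeroSum p r ks A m c S

import Data.Integer as Z
import Data.Integer.Divisibility as ZD

_≡_[mod_] : ℕ → ℕ → ℕ → Set
a ≡ b [mod p ] = Z.+ p ZD.∣ (Z.+ a Z.- Z.+ b)

-- A polynomial-method argument over ℤ/p, with finite differences in place of polynomials.
-- Points x ∈ ℕ^{r+1} record the length of a subsequence (coordinate 0) and the coordinates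
-- of its weighted sum in G = ⊕ ℤ/p^{kₜ}; let δ be the indicator of the lattice
-- p^k ℕ × ∏ₜ p^{kₜ} ℕ. Give direction 0 weight s = |A| and the others weight 1. By the
-- Frobenius congruence Δ^{p^e} ≡ (shift by p^e) − 1 (mod p), Δₜ^{p^{kₜ}} kills δ mod p, so by
-- pigeonhole every difference operator of total weight > s(p^k − 1) + d*(G) kills δ mod p.
-- For a term g of the sequence put T_g φ(x) = c₀ φ(x) + Σᵢ cᵢ φ(x + e₀ + aᵢ g), where
-- c₀ ≢ 0 and (cᵢ) annihilates the binomial moments of order < s of the nodes 0, a₁, …, a_s;
-- such c exists since the aᵢ are distinct mod p. Newton's formula shows that T_g lowers the
-- weighted degree by s, so for ms > s(p^k − 1) + d*(G) the composite of all T_g kills δ mod p.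
-- At the origin, the empty choice of terms contributes c₀^m ≢ 0, hence some nonempty choice of
-- terms and weights from A ends on the lattice: an A-weighted zero-sum of length divisible by p^k.
-- The bound on s_A(G) is the case k = k_r: a positive multiple of exp(G) below 2 exp(G) is exp(G).
module Submission where

open import Data.Fin.Base using (Fin)
open import Data.Nat.Base using (ℕ; suc; _<_)
open import Data.Nat.Primality using (Prime)

module Differences where

  open import Data.Fin as Fin using (Fin; zero; suc; toℕ)
  open import Data.Integer
    hiding (suc; _≤_; _<_; _≥_; _>_; _≤?_; _<?_; _≟_)
  import Data.Integer.Properties as ℤₚ
  open import Data.Integer.Tactic.RingSolver using (solve-∀)
  open import Data.Nat as ℕ using (ℕ; zero; suc)
  open import Data.Nat.Combinatorics using (_C_; nCk+nC[k+1]≡[n+1]C[k+1]; k>n⇒nCk≡0; nCk≡nC[n∸k]; nCn≡1)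
  open import Data.Nat.GeneralisedArithmetic using (iterate)
  import Data.Nat.Properties as ℕₚ
  open import Function using (_∘_)
  open import Relation.Binary.PropositionalEquality
  open import Algebra.Properties.Semiring.Sum ℤₚ.+-*-semiring
    using (sum-syntax; sum-cong-≗; ∑-distrib-+; sum-replicate-zero)

  module _ {P : Set} (σ : P → P) where

    Δ : (P → ℤ) → P → ℤ
    Δ φ x = φ (σ x) - φ x

    Δ^ : ℕ → (P → ℤ) → P → ℤ
    Δ^ zero    φ = φ
    Δ^ (suc k) φ = Δ (Δ^ k φ)

    Δ^-+ : ∀ a b φ → Δ^ (a ℕ.+ b) φ ≡ Δ^ a (Δ^ b φ)
    Δ^-+ zero    b φ = refl
    Δ^-+ (suc a) b φ = cong Δ (Δ^-+ a b φ)

    Δ^-suc : ∀ k φ → Δ^ (suc k) φ ≗ Δ^ k (Δ φ)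
    Δ^-suc k φ x = trans (cong (λ j → Δ^ j φ x) (ℕₚ.+-comm 1 k)) (cong (λ f → f x) (Δ^-+ k 1 φ))

    Δ-cong : ∀ {φ ψ} → φ ≗ ψ → Δ φ ≗ Δ ψ
    Δ-cong φ≗ψ x = cong₂ _-_ (φ≗ψ (σ x)) (φ≗ψ x)

    Δ^-cong : ∀ k {φ ψ} → φ ≗ ψ → Δ^ k φ ≗ Δ^ k ψ
    Δ^-cong zero    φ≗ψ = φ≗ψ
    Δ^-cong (suc k) φ≗ψ = Δ-cong (Δ^-cong k φ≗ψ)

    Δ-distrib-+ : ∀ φ ψ → Δ (λ x → φ x + ψ x) ≗ (λ x → Δ φ x + Δ ψ x)
    Δ-distrib-+ φ ψ y = difference-of-sums (φ (σ y)) (ψ (σ y)) (φ y) (ψ y)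
      where
      difference-of-sums : ∀ a b c d → (a + b) - (c + d) ≡ (a - c) + (b - d)
      difference-of-sums = solve-∀

    Δ^-distrib-+ : ∀ k φ ψ → Δ^ k (λ x → φ x + ψ x) ≗ (λ x → Δ^ k φ x + Δ^ k ψ x)
    Δ^-distrib-+ zero    φ ψ x = refl
    Δ^-distrib-+ (suc k) φ ψ x = trans (Δ-cong (Δ^-distrib-+ k φ ψ) x) (Δ-distrib-+ (Δ^ k φ) (Δ^ k ψ) x)

    Δ-distrib-* : ∀ c φ → Δ (λ x → c * φ x) ≗ (λ x → c * Δ φ x)
    Δ-distrib-* c φ y = scaled-difference c (φ (σ y)) (φ y)
      where
      scaled-difference : ∀ c a b → c * a - c * b ≡ c * (a - b)
      scaled-difference = solve-∀

    Δ-distrib-sum : ∀ {K} (f : Fin K → P → ℤ) → Δ (λ x → ∑[ i < K ] f i x) ≗ (λ x → ∑[ i < K ] Δ (f i) x)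
    Δ-distrib-sum {zero}  f y = refl
    Δ-distrib-sum {suc K} f y =
      trans (Δ-distrib-+ (f zero) (λ x → ∑[ i < K ] f (suc i) x) y) (cong (_+_ (Δ (f zero) y)) (Δ-distrib-sum (f ∘ suc) y))

    Δ^-zero : ∀ k {φ} → (∀ x → φ x ≡ 0ℤ) → ∀ x → Δ^ k φ x ≡ 0ℤ
    Δ^-zero zero    φ≡0 = φ≡0
    Δ^-zero (suc k) φ≡0 x = cong₂ _-_ (Δ^-zero k φ≡0 (σ x)) (Δ^-zero k φ≡0 x)

  module _ {P : Set} (σ τ : P → P) (στ≡τσ : ∀ x → σ (τ x) ≡ τ (σ x)) where

    Δ-comm : ∀ φ → Δ σ (Δ τ φ) ≗ Δ τ (Δ σ φ)
    Δ-comm φ y = trans (cong (λ z → (φ z - φ (σ y)) - (φ (τ y) - φ y)) (sym (στ≡τσ y)))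
                       (swap-middle (φ (σ (τ y))) (φ (σ y)) (φ (τ y)) (φ y))
      where
      swap-middle : ∀ a b c d → (a - b) - (c - d) ≡ (a - c) - (b - d)
      swap-middle = solve-∀

    Δ^-comm : ∀ k φ → Δ^ σ k (Δ τ φ) ≗ Δ τ (Δ^ σ k φ)
    Δ^-comm zero    φ x = refl
    Δ^-comm (suc k) φ x = trans (Δ-cong σ (Δ^-comm k φ) x) (Δ-comm (Δ^ σ k φ) x)

    Δ^-∘ : ∀ k φ → Δ^ σ k (φ ∘ τ) ≗ (Δ^ σ k φ ∘ τ)
    Δ^-∘ zero    φ x = refl
    Δ^-∘ (suc k) φ x = trans (Δ-cong σ (Δ^-∘ k φ) x) (cong (λ z → Δ^ σ k φ z - Δ^ σ k φ (τ x)) (sym (στ≡τσ x)))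

    iterate-comm : ∀ x b → iterate σ (τ x) b ≡ τ (iterate σ x b)
    iterate-comm x zero    = refl
    iterate-comm x (suc b) = trans (cong (λ z → iterate σ z b) (στ≡τσ x)) (iterate-comm (σ x) b)

  iterate-+ : ∀ {P : Set} (σ : P → P) y a b → iterate σ y (a ℕ.+ b) ≡ iterate σ (iterate σ y a) b
  iterate-+ σ y zero    b = refl
  iterate-+ σ y (suc a) b = iterate-+ σ (σ y) a b

  iterate-* : ∀ {P : Set} (σ : P → P) y q j → iterate (λ z → iterate σ z q) y j ≡ iterate σ y (j ℕ.* q)
  iterate-* σ y q zero    = refl
  iterate-* σ y q (suc j) = trans (iterate-* σ (iterate σ y q) q j) (sym (iterate-+ σ y q (j ℕ.* q)))

  sumBelow : ℕ → (ℕ → ℤ) → ℤ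
  sumBelow n f = ∑[ j < n ] f (toℕ j)

  sumBelow-cong : ∀ n {f g : ℕ → ℤ} → (∀ j → f j ≡ g j) → sumBelow n f ≡ sumBelow n g
  sumBelow-cong n f≗g = sum-cong-≗ {n} (f≗g ∘ toℕ)

  sumBelow-+ : ∀ n (f g : ℕ → ℤ) → sumBelow n (λ j → f j + g j) ≡ sumBelow n f + sumBelow n g
  sumBelow-+ n f g = ∑-distrib-+ {n} (f ∘ toℕ) (g ∘ toℕ)

  sumBelow-last : ∀ n (f : ℕ → ℤ) → sumBelow (suc n) f ≡ sumBelow n f + f n
  sumBelow-last zero    f = trans (ℤₚ.+-identityʳ (f 0)) (sym (ℤₚ.+-identityˡ (f 0)))
  sumBelow-last (suc n) f = trans (cong (_+_ (f 0)) (sumBelow-last n (f ∘ suc)))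
                                  (sym (ℤₚ.+-assoc (f 0) (sumBelow n (f ∘ suc)) (f (suc n))))

  sumBelow-extend : ∀ n (f : ℕ → ℤ) → f n ≡ 0ℤ → sumBelow (suc n) f ≡ sumBelow n f
  sumBelow-extend n f fn≡0 =
    trans (sumBelow-last n f) (trans (cong (_+_ (sumBelow n f)) fn≡0) (ℤₚ.+-identityʳ (sumBelow n f)))

  C-zeroʳ : ∀ n → n C 0 ≡ 1
  C-zeroʳ n = trans (nCk≡nC[n∸k] {n = n} ℕ.z≤n) (nCn≡1 n)

  pascal-sum : ∀ b N (a : ℕ → ℤ) →
    sumBelow (suc N) (λ j → + (suc b C j) * a j)
      ≡ sumBelow (suc N) (λ j → + (b C j) * a j) + sumBelow N (λ j → + (b C j) * a (suc j))
  pascal-sum b N a = begin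
    + (suc b C 0) * a 0 + sumBelow N (λ j → + (suc b C suc j) * a (suc j))
      ≡⟨ cong₂ _+_ (cong (λ c → + c * a 0) (trans (C-zeroʳ (suc b)) (sym (C-zeroʳ b))))
                   (sumBelow-cong N λ j → cong (λ c → + c * a (suc j)) (sym (nCk+nC[k+1]≡[n+1]C[k+1] b j))) ⟩
    + (b C 0) * a 0 + sumBelow N (λ j → + (b C j ℕ.+ b C suc j) * a (suc j))
      ≡⟨ cong (_+_ (+ (b C 0) * a 0)) (trans (sumBelow-cong N λ j → pascal-term (b C j) (b C suc j) (a (suc j)))
                                          (sumBelow-+ N (λ j → + (b C suc j) * a (suc j)) (λ j → + (b C j) * a (suc j)))) ⟩
    + (b C 0) * a 0 + (sumBelow N (λ j → + (b C suc j) * a (suc j)) + sumBelow N (λ j → + (b C j) * a (suc j)))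
      ≡⟨ ℤₚ.+-assoc (+ (b C 0) * a 0) (sumBelow N (λ j → + (b C suc j) * a (suc j)))
                    (sumBelow N (λ j → + (b C j) * a (suc j))) ⟨
    sumBelow (suc N) (λ j → + (b C j) * a j) + sumBelow N (λ j → + (b C j) * a (suc j)) ∎
    where
    open ≡-Reasoning
    pascal-term : ∀ c d x → + (c ℕ.+ d) * x ≡ + d * x + + c * x
    pascal-term c d x = trans (cong (_* x) (ℤₚ.pos-+ c d))
                              (trans (ℤₚ.*-distribʳ-+ x (+ c) (+ d)) (ℤₚ.+-comm (+ c * x) (+ d * x)))

  newton : ∀ {P : Set} (σ : P → P) φ b N → b ℕ.≤ N → ∀ y →
           φ (iterate σ y b) ≡ sumBelow (suc N) (λ j → + (b C j) * Δ^ σ j φ y)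
  newton σ φ zero N _ y = begin
    φ y                   ≡⟨ ℤₚ.*-identityˡ (φ y) ⟨
    + 1 * φ y             ≡⟨ cong (λ c → + c * φ y) (C-zeroʳ 0) ⟨
    + (0 C 0) * φ y       ≡⟨ ℤₚ.+-identityʳ _ ⟨
    + (0 C 0) * φ y + 0ℤ  ≡⟨ cong (_+_ (+ (0 C 0) * φ y)) (trans (sumBelow-cong N λ j → cong (λ c → + c * Δ^ σ (suc j) φ y)
                                                                                       (k>n⇒nCk≡0 {0} {suc j} (ℕ.s≤s ℕ.z≤n)))
                                                             (sum-replicate-zero N)) ⟨
    sumBelow (suc N) (λ j → + (0 C j) * Δ^ σ j φ y) ∎
    where
    open ≡-Reasoning
  newton σ φ (suc b) (suc N) (ℕ.s≤s b≤N) y = begin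
    φ (iterate σ (σ y) b)
      ≡⟨ newton σ φ b N b≤N (σ y) ⟩
    sumBelow (suc N) (λ j → c j * Δ^ σ j φ (σ y))
      ≡⟨ sumBelow-cong (suc N) (λ j → split-shifted (c j) (a j) (Δ^ σ j φ (σ y))) ⟩
    sumBelow (suc N) (λ j → c j * a j + c j * a (suc j))
      ≡⟨ sumBelow-+ (suc N) (λ j → c j * a j) (λ j → c j * a (suc j)) ⟩
    sumBelow (suc N) (λ j → c j * a j) + sumBelow (suc N) (λ j → c j * a (suc j))
      ≡⟨ cong (_+ sumBelow (suc N) (λ j → c j * a (suc j)))
              (sumBelow-extend (suc N) (λ j → c j * a j)
                               (trans (cong (λ k → + k * a (suc N)) (k>n⇒nCk≡0 {b} {suc N} (ℕ.s≤s b≤N)))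
                                      (ℤₚ.*-zeroˡ (a (suc N))))) ⟨
    sumBelow (suc (suc N)) (λ j → c j * a j) + sumBelow (suc N) (λ j → c j * a (suc j))
      ≡⟨ pascal-sum b (suc N) a ⟨
    sumBelow (suc (suc N)) (λ j → + (suc b C j) * a j) ∎
    where
    open ≡-Reasoning
    c : ℕ → ℤ
    c j = + (b C j)
    a : ℕ → ℤ
    a j = Δ^ σ j φ y
    split-shifted : ∀ c u v → c * v ≡ c * u + c * (v - u)
    split-shifted = solve-∀

module NatSums where

  open import Data.Fin using (Fin; zero; suc)
  open import Data.Fin.Properties using (suc-injective)
  open import Data.Nat using (ℕ; zero; suc; _+_)
  import Data.Nat.Properties as ℕₚ
  open import Defs using (∑)
  open import Function using (_∘_)
  open import Relation.Binary.PropositionalEquality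

  ∑-cong : ∀ m {f g : Fin m → ℕ} → (∀ i → f i ≡ g i) → ∑ m f ≡ ∑ m g
  ∑-cong zero    f≗g = refl
  ∑-cong (suc m) f≗g = cong₂ _+_ (f≗g zero) (∑-cong m (f≗g ∘ suc))

  ∑-zero : ∀ m (f : Fin m → ℕ) → (∀ i → f i ≡ 0) → ∑ m f ≡ 0
  ∑-zero zero    f f≡0 = refl
  ∑-zero (suc m) f f≡0 = cong₂ _+_ (f≡0 zero) (∑-zero m (f ∘ suc) (f≡0 ∘ suc))

  ∑-update : ∀ m (f g : Fin m → ℕ) u c → (∀ i → i ≢ u → f i ≡ g i) → f u ≡ g u + c → ∑ m f ≡ ∑ m g + c
  ∑-update (suc m) f g zero c f≗g fu≡gu+c = begin
    f zero + ∑ m (f ∘ suc)      ≡⟨ cong₂ _+_ fu≡gu+c (∑-cong m (λ i → f≗g (suc i) λ ()))  ⟩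
    g zero + c + ∑ m (g ∘ suc)  ≡⟨ ℕₚ.+-assoc (g zero) c _ ⟩
    g zero + (c + ∑ m (g ∘ suc)) ≡⟨ cong (g zero +_) (ℕₚ.+-comm c _) ⟩
    g zero + (∑ m (g ∘ suc) + c) ≡⟨ ℕₚ.+-assoc (g zero) _ c ⟨
    g zero + ∑ m (g ∘ suc) + c  ∎
    where open ≡-Reasoning
  ∑-update (suc m) f g (suc u) c f≗g fu≡gu+c =
    trans (cong₂ _+_ (f≗g zero λ ())
                     (∑-update m (f ∘ suc) (g ∘ suc) u c (λ i i≢u → f≗g (suc i) (i≢u ∘ suc-injective)) fu≡gu+c))
          (sym (ℕₚ.+-assoc (g zero) _ c))

module Congruence (p : ℕ) where

  open import Data.Fin using (Fin; zero; suc; toℕ)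
  open import Data.Integer
    hiding (suc; _≤_; _<_; _≥_; _>_; _≤?_; _<?_; _≟_)
  import Data.Integer.Properties as ℤₚ
  open import Data.Integer.Divisibility.Signed
    using (_∣_; divides; _∣?_; ∣ᵤ⇒∣; ∣⇒∣ᵤ; ∣m∣n⇒∣m+n; ∣m∣n⇒∣m-n; ∣m⇒∣-m; ∣n⇒∣m*n; ∣m⇒∣m*n)
  open import Data.Integer.Tactic.RingSolver using (solve-∀)
  open import Data.Nat as ℕ using (ℕ; zero; suc; _!)
  open import Data.Nat.Combinatorics using (_C_; nCn≡1; nCk≡n!/k![n-k]!; k![n∸k]!∣n!)
  open import Data.Nat.GeneralisedArithmetic using (iterate)
  open import Data.Nat.Properties as ℕₚ using (_!*_!≢0)
  open import Data.Product using (Σ; _,_)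
  open import Function using (_∘_)
  open import Relation.Binary.Bundles using (Setoid)
  open import Relation.Binary.PropositionalEquality
  open import Data.Empty using (⊥-elim)
  open import Data.Fin.Properties using (toℕ<n)
  import Data.Nat.DivMod as ℕ/
  open import Data.Nat.Divisibility as ℕ∣ using ()
  open import Data.Nat.Primality using (Prime; euclidsLemma; prime⇒nonZero; prime⇒nonTrivial)
  open import Data.Sum using (inj₁; inj₂)
  import Relation.Binary.Reasoning.Setoid
  open import Relation.Nullary using (¬_; yes; no)
  open import Algebra.Properties.Semiring.Sum ℤₚ.+-*-semiring
    using (sum; sum-syntax; sum-cong-≗; ∑-comm; *-distribˡ-sum)
  open Differences

  ∣0 : + p ∣ 0ℤ
  ∣0 = divides 0ℤ refl

  infix 4 _≋_
  _≋_ : ℤ → ℤ → Set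
  x ≋ y = + p ∣ x - y

  ≋-setoid : Setoid _ _
  ≋-setoid = record
    { Carrier       = ℤ
    ; _≈_           = _≋_
    ; isEquivalence = record
      { refl  = λ {x} → subst (+ p ∣_) (sym (ℤₚ.+-inverseʳ x)) ∣0
      ; sym   = λ {x} {y} x≋y → subst (+ p ∣_) (x-y≡-[y-x] y x) (∣m⇒∣-m x≋y)
      ; trans = λ {x} {y} {z} x≋y y≋z → subst (+ p ∣_) (sym (x-z≡[x-y]+[y-z] x y z)) (∣m∣n⇒∣m+n x≋y y≋z)
      }
    }
    where
    x-y≡-[y-x] : ∀ x y → - (y - x) ≡ x - y
    x-y≡-[y-x] = solve-∀
    x-z≡[x-y]+[y-z] : ∀ x y z → x - z ≡ (x - y) + (y - z)
    x-z≡[x-y]+[y-z] = solve-∀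

  open Setoid ≋-setoid using () renaming (refl to ≋-refl)

  Vanishes : {P : Set} → (P → ℤ) → Set
  Vanishes φ = ∀ x → + p ∣ φ x

  ∣-sum : ∀ n (f : Fin n → ℤ) → (∀ i → + p ∣ f i) → + p ∣ sum f
  ∣-sum zero    f p∣f = ∣0
  ∣-sum (suc n) f p∣f = ∣m∣n⇒∣m+n (p∣f zero) (∣-sum n (f ∘ suc) (p∣f ∘ suc))

  ∤-sum⇒∤-term : ∀ n (f : Fin n → ℤ) → ¬ + p ∣ sum f → Σ (Fin n) λ i → ¬ + p ∣ f i
  ∤-sum⇒∤-term zero    f p∤∑ = ⊥-elim (p∤∑ (∣-sum zero f λ ()))
  ∤-sum⇒∤-term (suc n) f p∤∑ with + p ∣? f zero
  ... | no  p∤f₀ = zero , p∤f₀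
  ... | yes p∣f₀ with ∤-sum⇒∤-term n (f ∘ suc) (p∤∑ ∘ ∣m∣n⇒∣m+n p∣f₀)
  ...   | i , p∤fᵢ = suc i , p∤fᵢ

  Δ-cong-≋ : ∀ {P : Set} (σ : P → P) {φ ψ : P → ℤ} → (∀ x → φ x ≋ ψ x) → ∀ y → Δ σ φ y ≋ Δ σ ψ y
  Δ-cong-≋ σ {φ} {ψ} φ≋ψ y =
    subst (+ p ∣_) (sym (difference-of-differences (φ (σ y)) (φ y) (ψ (σ y)) (ψ y)))
          (∣m∣n⇒∣m-n (φ≋ψ (σ y)) (φ≋ψ y))
    where
    difference-of-differences : ∀ a b c d → (a - b) - (c - d) ≡ (a - c) - (b - d)
    difference-of-differences = solve-∀

  lowMoments⇒∣weightedSum :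
    ∀ {P : Set} (σ : P → P) (χ : P → ℤ) y (B s : ℕ) {n} (ν : Fin n → ℕ) (c : Fin n → ℤ) →
    (∀ i → ν i ℕ.≤ B) →
    (∀ j → s ℕ.≤ j → + p ∣ Δ^ σ j χ y) →
    (∀ j → j ℕ.< s → + p ∣ ∑[ i < n ] (+ (ν i C j) * c i)) →
    + p ∣ ∑[ i < n ] (c i * χ (iterate σ y (ν i)))
  lowMoments⇒∣weightedSum σ χ y B s {n} ν c ν≤B high low =
    subst (+ p ∣_) (sym expand) (∣-sum (suc B) (λ j → moment (toℕ j) * a (toℕ j)) term)
    where
    open ≡-Reasoning
    a : ℕ → ℤ
    a j = Δ^ σ j χ y
    moment : ℕ → ℤ
    moment j = ∑[ i < n ] (+ (ν i C j) * c i)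
    term : ∀ j → + p ∣ moment (toℕ j) * a (toℕ j)
    term j with toℕ j ℕ.<? s
    ... | yes j<s = ∣m⇒∣m*n (a (toℕ j)) (low (toℕ j) j<s)
    ... | no  j≮s = ∣n⇒∣m*n (moment (toℕ j)) (high (toℕ j) (ℕₚ.≮⇒≥ j≮s))
    regroup : ∀ c b x → c * (b * x) ≡ x * (b * c)
    regroup = solve-∀
    expand : ∑[ i < n ] (c i * χ (iterate σ y (ν i))) ≡ sumBelow (suc B) (λ j → moment j * a j)
    expand = begin
      ∑[ i < n ] (c i * χ (iterate σ y (ν i)))
        ≡⟨ sum-cong-≗ {n} (λ i → cong (c i *_) (newton σ χ (ν i) B (ν≤B i) y)) ⟩
      ∑[ i < n ] (c i * sumBelow (suc B) (λ j → + (ν i C j) * a j))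
        ≡⟨ sum-cong-≗ {n} (λ i → *-distribˡ-sum {suc B} (c i) (λ j → + (ν i C toℕ j) * a (toℕ j))) ⟩
      ∑[ i < n ] ∑[ j < suc B ] (c i * (+ (ν i C toℕ j) * a (toℕ j)))
        ≡⟨ ∑-comm {n} {suc B} (λ i j → c i * (+ (ν i C toℕ j) * a (toℕ j))) ⟩
      ∑[ j < suc B ] ∑[ i < n ] (c i * (+ (ν i C toℕ j) * a (toℕ j)))
        ≡⟨ sum-cong-≗ {suc B} (λ j → trans (sum-cong-≗ {n} λ i → regroup (c i) (+ (ν i C toℕ j)) (a (toℕ j)))
                                          (trans (sym (*-distribˡ-sum {n} (a (toℕ j)) (λ i → + (ν i C toℕ j) * c i)))
                                                 (ℤₚ.*-comm (a (toℕ j)) (moment (toℕ j))))) ⟩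
      sumBelow (suc B) (λ j → moment j * a j) ∎

  -- The inner terms of Newton's expansion of φ (σ^{q+1} y) vanish mod p.
  binomialFrobenius : ∀ {P : Set} (σ : P → P) q → (∀ j → j ℕ.< q → + p ∣ + (suc q C suc j)) →
                      ∀ φ y → Δ^ σ (suc q) φ y ≋ Δ (λ z → iterate σ z (suc q)) φ y
  binomialFrobenius σ q p∣C φ y =
    subst (+ p ∣_) (sym difference≡-middle) (∣m⇒∣-m (∣-sum q (λ j → f (suc (toℕ j))) middle-terms))
    where
    a : ℕ → ℤ
    a j = Δ^ σ j φ y
    f : ℕ → ℤ
    f j = + (suc q C j) * a j
    middle-terms : ∀ j → + p ∣ f (suc (toℕ j))
    middle-terms j = ∣m⇒∣m*n (a (suc (toℕ j))) (p∣C (toℕ j) (toℕ<n j))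
    middle : ℤ
    middle = sumBelow q (f ∘ suc)
    expansion : φ (iterate σ y (suc q)) ≡ (a 0 + middle) + a (suc q)
    expansion = begin
      φ (iterate σ y (suc q))          ≡⟨ newton σ φ (suc q) (suc q) ℕₚ.≤-refl y ⟩
      sumBelow (suc (suc q)) f         ≡⟨ sumBelow-last (suc q) f ⟩
      (f 0 + middle) + f (suc q)       ≡⟨ cong₂ (λ u v → (u + middle) + v)
                                                (trans (cong (λ c → + c * a 0) (C-zeroʳ (suc q))) (ℤₚ.*-identityˡ (a 0)))
                                                (trans (cong (λ c → + c * a (suc q)) (nCn≡1 (suc q))) (ℤₚ.*-identityˡ (a (suc q)))) ⟩
      (a 0 + middle) + a (suc q)       ∎
      where open ≡-Reasoning
    cancel : ∀ d a₀ m → d - (((a₀ + m) + d) - a₀) ≡ - m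
    cancel = solve-∀
    difference≡-middle : a (suc q) - (φ (iterate σ y (suc q)) - φ y) ≡ - middle
    difference≡-middle = trans (cong (λ t → a (suc q) - (t - φ y)) expansion) (cancel (a (suc q)) (a 0) middle)

  Δ^-*-≋ : ∀ {P : Set} (σ : P → P) q → (∀ φ y → Δ^ σ q φ y ≋ Δ (λ z → iterate σ z q) φ y) →
           ∀ j φ y → Δ^ σ (j ℕ.* q) φ y ≋ Δ^ (λ z → iterate σ z q) j φ y
  Δ^-*-≋ σ q frob zero    φ y = ≋-refl {φ y}
  Δ^-*-≋ σ q frob (suc j) φ y = begin
    Δ^ σ (q ℕ.+ j ℕ.* q) φ y       ≡⟨ cong (λ ψ → ψ y) (Δ^-+ σ q (j ℕ.* q) φ) ⟩
    Δ^ σ q (Δ^ σ (j ℕ.* q) φ) y    ≈⟨ frob (Δ^ σ (j ℕ.* q) φ) y ⟩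
    Δ τ (Δ^ σ (j ℕ.* q) φ) y       ≈⟨ Δ-cong-≋ τ {Δ^ σ (j ℕ.* q) φ} {Δ^ τ j φ} (Δ^-*-≋ σ q frob j φ) y ⟩
    Δ τ (Δ^ τ j φ) y               ∎
    where
    open Relation.Binary.Reasoning.Setoid ≋-setoid
    τ : _ → _
    τ z = iterate σ z q

  module _ (prime : Prime p) where

    private
      p≢1 : p ≢ 1
      p≢1 = ℕ.nonTrivial⇒≢1 {{prime⇒nonTrivial prime}}

    ∤-* : ∀ {a b} → ¬ + p ∣ a → ¬ + p ∣ b → ¬ + p ∣ a * b
    ∤-* {a} {b} p∤a p∤b p∣ab
      with euclidsLemma ∣ a ∣ ∣ b ∣ prime (subst (λ n → p ℕ∣.∣ n) (ℤₚ.abs-* a b) (∣⇒∣ᵤ p∣ab))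
    ... | inj₁ p∣a = p∤a (∣ᵤ⇒∣ p∣a)
    ... | inj₂ p∣b = p∤b (∣ᵤ⇒∣ p∣b)

    ∣*∤⇒∣ : ∀ {a b} → + p ∣ a * b → ¬ + p ∣ b → + p ∣ a
    ∣*∤⇒∣ {a} p∣ab p∤b with + p ∣? a
    ... | yes p∣a = p∣a
    ... | no  p∤a = ⊥-elim (∤-* p∤a p∤b p∣ab)

    ∤1 : ¬ + p ∣ 1ℤ
    ∤1 p∣1 = p≢1 (ℕ∣.∣1⇒≡1 (∣⇒∣ᵤ p∣1))

    ∤-^ : ∀ {a} → ¬ + p ∣ a → ∀ m → ¬ + p ∣ a ^ m
    ∤-^ p∤a zero    = ∤1
    ∤-^ p∤a (suc m) = ∤-* p∤a (∤-^ p∤a m)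

    ∤! : ∀ {m} → m ℕ.< p → ¬ p ℕ∣.∣ m !
    ∤! {zero}  _   p∣1  = p≢1 (ℕ∣.∣1⇒≡1 p∣1)
    ∤! {suc m} m<p p∣m! with euclidsLemma (suc m) (m !) prime p∣m!
    ... | inj₁ p∣1+m = ℕₚ.<⇒≱ m<p (ℕ∣.∣⇒≤ p∣1+m)
    ... | inj₂ p∣m!  = ∤! (ℕₚ.<-trans (ℕₚ.n<1+n m) m<p) p∣m!

    ∣C : ∀ {j} → 0 ℕ.< j → j ℕ.< p → p ℕ∣.∣ p C j
    ∣C {j} 0<j j<p with euclidsLemma (p C j) (j ! ℕ.* (p ℕ.∸ j) !) prime p∣C·denominator
      where
      instance _ = j !* (p ℕ.∸ j) !≢0
      p∣C·denominator : p ℕ∣.∣ (p C j) ℕ.* (j ! ℕ.* (p ℕ.∸ j) !)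
      p∣C·denominator = subst (λ n → p ℕ∣.∣ n)
        (sym (trans (cong (λ c → c ℕ.* (j ! ℕ.* (p ℕ.∸ j) !)) (nCk≡n!/k![n-k]! {p} {j} (ℕₚ.<⇒≤ j<p)))
                    (ℕ/.m/n*n≡m (k![n∸k]!∣n! {p} {j} (ℕₚ.<⇒≤ j<p)))))
        (n∣n! p {{prime⇒nonZero prime}})
        where
        n∣n! : ∀ n → .{{ℕ.NonZero n}} → n ℕ∣.∣ n !
        n∣n! (suc n) = ℕ∣.m∣m*n (n !)
    ... | inj₁ p∣C = p∣C
    ... | inj₂ p∣denominator with euclidsLemma (j !) ((p ℕ.∸ j) !) prime p∣denominator
    ...   | inj₁ p∣j!     = ⊥-elim (∤! j<p p∣j!)
    ...   | inj₂ p∣[p-j]! = ⊥-elim (∤! (ℕₚ.∸-monoʳ-< 0<j (ℕₚ.<⇒≤ j<p)) p∣[p-j]!)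

    frobenius : ∀ {P : Set} (σ : P → P) φ y → Δ^ σ p φ y ≋ Δ (λ z → iterate σ z p) φ y
    frobenius σ φ y =
      subst (λ q → Δ^ σ q φ y ≋ Δ (λ z → iterate σ z q) φ y) 1+[p-1]≡p
            (binomialFrobenius σ (ℕ.pred p) p∣C φ y)
      where
      1+[p-1]≡p : suc (ℕ.pred p) ≡ p
      1+[p-1]≡p = ℕₚ.suc-pred p {{prime⇒nonZero prime}}
      p∣C : ∀ j → j ℕ.< ℕ.pred p → + p ∣ + (suc (ℕ.pred p) C suc j)
      p∣C j j<p-1 = ∣ᵤ⇒∣ (subst (λ q → p ℕ∣.∣ q C suc j) (sym 1+[p-1]≡p)
                                (∣C (ℕ.s≤s ℕ.z≤n) (subst (suc j ℕ.<_) 1+[p-1]≡p (ℕ.s≤s j<p-1))))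

    frobenius^ : ∀ k {P : Set} (σ : P → P) φ y → Δ^ σ (p ℕ.^ k) φ y ≋ Δ (λ z → iterate σ z (p ℕ.^ k)) φ y
    frobenius^ zero    σ φ y = ≋-refl {Δ σ φ y}
    frobenius^ (suc k) σ φ y = begin
      Δ^ σ (p ℕ.* p ℕ.^ k) φ y   ≈⟨ Δ^-*-≋ σ (p ℕ.^ k) (frobenius^ k σ) p φ y ⟩
      Δ^ τ p φ y                 ≈⟨ frobenius τ φ y ⟩
      Δ (λ z → iterate τ z p) φ y ≡⟨ cong (λ t → t - φ y) (cong φ (iterate-* σ y (p ℕ.^ k) p)) ⟩
      Δ (λ z → iterate σ z (p ℕ.* p ℕ.^ k)) φ y ∎
      where
      open Relation.Binary.Reasoning.Setoid ≋-setoid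
      τ : _ → _
      τ z = iterate σ z (p ℕ.^ k)

module Occurrences where

  open import Data.Bool using (if_then_else_)
  open import Data.Fin using (Fin; zero; suc; _≟_)
  open import Data.List using (List; []; _∷_; _++_; map; replicate)
  open import Data.Nat using (ℕ; zero; suc; _+_)
  import Data.Nat.Properties as ℕₚ
  open import Function using (_∘_)
  open import Relation.Binary.PropositionalEquality
  open import Relation.Nullary using (does)

  count : ∀ {r} → Fin r → List (Fin r) → ℕ
  count u []      = 0
  count u (t ∷ w) = (if does (u ≟ t) then 1 else 0) + count u w

  count-++ : ∀ {r} (u : Fin r) w w′ → count u (w ++ w′) ≡ count u w + count u w′
  count-++ u []      w′ = refl
  count-++ u (t ∷ w) w′ = trans (cong (_ +_) (count-++ u w w′)) (sym (ℕₚ.+-assoc _ (count u w) (count u w′)))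

  count-map-suc : ∀ {r} (u : Fin r) w → count (suc u) (map suc w) ≡ count u w
  count-map-suc u []      = refl
  count-map-suc u (t ∷ w) = cong (_ +_) (count-map-suc u w)

  count-zero-map-suc : ∀ {r} (w : List (Fin r)) → count zero (map suc w) ≡ 0
  count-zero-map-suc []      = refl
  count-zero-map-suc (t ∷ w) = count-zero-map-suc w

  word : ∀ {r} → (Fin r → ℕ) → List (Fin r)
  word {zero}  g = []
  word {suc r} g = replicate (g zero) zero ++ map suc (word (g ∘ suc))

  count-word : ∀ {r} (g : Fin r → ℕ) t → count t (word g) ≡ g t
  count-word {suc r} g t = trans (count-++ t (replicate (g zero) zero) (map suc (word (g ∘ suc)))) (split t)
    where
    count-zeros : ∀ u k → count u (replicate k zero) ≡ (if does (u ≟ zero) then k else 0)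
    count-zeros zero    zero    = refl
    count-zeros zero    (suc k) = cong suc (count-zeros zero k)
    count-zeros (suc u) zero    = refl
    count-zeros (suc u) (suc k) = count-zeros (suc u) k
    split : ∀ t → count t (replicate (g zero) zero) + count t (map suc (word (g ∘ suc))) ≡ g t
    split zero    = trans (cong₂ _+_ (count-zeros zero (g zero)) (count-zero-map-suc (word (g ∘ suc)))) (ℕₚ.+-identityʳ (g zero))
    split (suc u) = trans (cong₂ _+_ (count-zeros (suc u) (g zero)) (count-map-suc u (word (g ∘ suc)))) (count-word (g ∘ suc) u)

module Lattice (R : ℕ) where

  open import Data.Bool using (if_then_else_)
  open import Data.Fin using (Fin; zero; suc; _≟_)
  open import Data.List using (List; []; _∷_)
  open import Data.Nat using (ℕ; zero; suc; _+_; _*_)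
  import Data.Nat.Properties as ℕₚ
  open import Data.Nat.GeneralisedArithmetic using (iterate)
  open import Data.Vec using (Vec; lookup; updateAt)
  open import Data.Vec.Properties using (updateAt-commutes; lookup∘updateAt; lookup∘updateAt′)
  open import Relation.Binary.PropositionalEquality
  open import Relation.Nullary using (does; yes; no)
  open Occurrences using (count)

  Point : Set
  Point = Vec ℕ R

  shift : Fin R → Point → Point
  shift t x = updateAt x t suc

  shift-comm : ∀ t u x → shift t (shift u x) ≡ shift u (shift t x)
  shift-comm t u x with t ≟ u
  ... | yes refl = refl
  ... | no  t≢u  = updateAt-commutes t u t≢u x

  walk : List (Fin R) → Point → Point
  walk []      x = x
  walk (t ∷ w) x = walk w (shift t x)

  walk-shift : ∀ w u x → walk w (shift u x) ≡ shift u (walk w x)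
  walk-shift []      u x = refl
  walk-shift (t ∷ w) u x = trans (cong (walk w) (shift-comm t u x)) (walk-shift w u (shift t x))

  lookup-shift : ∀ t x u → lookup (shift t x) u ≡ lookup x u + (if does (u ≟ t) then 1 else 0)
  lookup-shift t x u with u ≟ t
  ... | yes refl = trans (lookup∘updateAt u x) (ℕₚ.+-comm 1 (lookup x u))
  ... | no  u≢t  = trans (lookup∘updateAt′ u t u≢t x) (sym (ℕₚ.+-identityʳ (lookup x u)))

  lookup-walk : ∀ w x u → lookup (walk w x) u ≡ lookup x u + count u w
  lookup-walk []      x u = sym (ℕₚ.+-identityʳ (lookup x u))
  lookup-walk (t ∷ w) x u = begin
    lookup (walk w (shift t x)) u                                   ≡⟨ lookup-walk w (shift t x) u ⟩
    lookup (shift t x) u + count u w                               ≡⟨ cong (_+ count u w) (lookup-shift t x u) ⟩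
    lookup x u + (if does (u ≟ t) then 1 else 0) + count u w       ≡⟨ ℕₚ.+-assoc (lookup x u) _ (count u w) ⟩
    lookup x u + count u (t ∷ w)                                   ∎
    where open ≡-Reasoning

  lookup-iterate-walk : ∀ w b x u → lookup (iterate (walk w) x b) u ≡ lookup x u + b * count u w
  lookup-iterate-walk w zero    x u = sym (ℕₚ.+-identityʳ (lookup x u))
  lookup-iterate-walk w (suc b) x u = begin
    lookup (iterate (walk w) (walk w x) b) u        ≡⟨ lookup-iterate-walk w b (walk w x) u ⟩
    lookup (walk w x) u + b * count u w             ≡⟨ cong (_+ b * count u w) (lookup-walk w x u) ⟩
    lookup x u + count u w + b * count u w          ≡⟨ ℕₚ.+-assoc (lookup x u) (count u w) _ ⟩
    lookup x u + suc b * count u w                  ∎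
    where open ≡-Reasoning

  lookup-iterate-shift : ∀ t k x → lookup (iterate (shift t) x k) t ≡ lookup x t + k
  lookup-iterate-shift t zero    x = sym (ℕₚ.+-identityʳ (lookup x t))
  lookup-iterate-shift t (suc k) x = trans (lookup-iterate-shift t k (shift t x))
    (trans (cong (_+ k) (lookup∘updateAt t x)) (sym (ℕₚ.+-suc (lookup x t) k)))

  lookup-iterate-shift′ : ∀ t k x u → u ≢ t → lookup (iterate (shift t) x k) u ≡ lookup x u
  lookup-iterate-shift′ t zero    x u u≢t = refl
  lookup-iterate-shift′ t (suc k) x u u≢t =
    trans (lookup-iterate-shift′ t k (shift t x) u u≢t) (lookup∘updateAt′ u t u≢t x)

module WeightedDegree (R : ℕ) (wt : Fin R → ℕ) (p : ℕ) where

  open import Data.Fin using (Fin; zero; suc; _≟_)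
  open import Data.Integer using (ℤ; +_; _+_; _-_; _*_)
  open import Data.Integer.Divisibility.Signed using (_∣_; ∣m∣n⇒∣m+n; ∣m∣n⇒∣m-n)
  open import Data.Integer.Tactic.RingSolver using (solve-∀)
  import Data.Integer.Properties as ℤₚ
  open import Data.List using (List; []; _∷_; _++_; map)
  open import Data.List.Properties using (map-++)
  open import Data.Nat.ListAction using (sum)
  open import Data.Nat.ListAction.Properties using (sum-++)
  open import Data.List.Relation.Unary.All using (All; []; _∷_)
  open import Data.Nat as ℕ using (ℕ; zero; suc; _≤_; z≤n)
  import Data.Nat.Properties as ℕₚ
  open import Data.Vec.Functional using (updateAt)
  open import Data.Vec.Functional.Properties using (updateAt-updates; updateAt-minimal)
  open import Defs using (∑)
  open import Function using (_∘_)
  open import Relation.Binary.PropositionalEquality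
  open import Relation.Nullary using (yes; no)
  open import Algebra.Properties.Semiring.Sum ℤₚ.+-*-semiring using (sum-syntax)
  open Differences
  open Congruence p using (Vanishes; ∣0)
  open Lattice R
  open NatSums using (∑-update)

  Fn : Set
  Fn = Point → ℤ

  Δw : List (Fin R) → Fn → Fn
  Δw []      φ = φ
  Δw (t ∷ w) φ = Δw w (Δ (shift t) φ)

  weight : List (Fin R) → ℕ
  weight w = sum (map wt w)

  Deg< : ℕ → Fn → Set
  Deg< d φ = ∀ w → d ≤ weight w → Vanishes (Δw w φ)

  Δw-cong : ∀ w {φ ψ : Fn} → φ ≗ ψ → Δw w φ ≗ Δw w ψ
  Δw-cong []      φ≗ψ = φ≗ψ
  Δw-cong (t ∷ w) φ≗ψ = Δw-cong w (Δ-cong (shift t) φ≗ψ)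

  Δw-++ : ∀ w w' φ → Δw (w ++ w') φ ≡ Δw w' (Δw w φ)
  Δw-++ []      w' φ = refl
  Δw-++ (t ∷ w) w' φ = Δw-++ w w' (Δ (shift t) φ)

  weight-++ : ∀ w w' → weight (w ++ w') ≡ weight w ℕ.+ weight w'
  weight-++ w w' = trans (cong sum (map-++ wt w w')) (sum-++ (map wt w) (map wt w'))

  Δw-distrib-+ : ∀ w (φ ψ : Fn) → Δw w (λ x → φ x + ψ x) ≗ (λ x → Δw w φ x + Δw w ψ x)
  Δw-distrib-+ []      φ ψ x = refl
  Δw-distrib-+ (t ∷ w) φ ψ x =
    trans (Δw-cong w (Δ-distrib-+ (shift t) φ ψ) x) (Δw-distrib-+ w (Δ (shift t) φ) (Δ (shift t) ψ) x)

  Δw-distrib-* : ∀ w c (φ : Fn) → Δw w (λ x → c * φ x) ≗ (λ x → c * Δw w φ x)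
  Δw-distrib-* []      c φ x = refl
  Δw-distrib-* (t ∷ w) c φ x = trans (Δw-cong w (Δ-distrib-* (shift t) c φ) x) (Δw-distrib-* w c (Δ (shift t) φ) x)

  Δw-distrib-sum : ∀ w {K} (f : Fin K → Fn) → Δw w (λ x → ∑[ i < K ] f i x) ≗ (λ x → ∑[ i < K ] Δw w (f i) x)
  Δw-distrib-sum []      f x = refl
  Δw-distrib-sum (t ∷ w) f x =
    trans (Δw-cong w (Δ-distrib-sum (shift t) f) x) (Δw-distrib-sum w (λ i → Δ (shift t) (f i)) x)

  Equivariant : (Point → Point) → Set
  Equivariant τ = ∀ t x → τ (shift t x) ≡ shift t (τ x)

  Δw-∘ : ∀ w {τ} → Equivariant τ → ∀ (φ : Fn) → Δw w (φ ∘ τ) ≗ (Δw w φ ∘ τ)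
  Δw-∘ []      τ-eq φ x = refl
  Δw-∘ (t ∷ w) {τ} τ-eq φ x =
    trans (Δw-cong w (λ y → cong (λ z → φ z Data.Integer.- φ (τ y)) (τ-eq t y)) x) (Δw-∘ w τ-eq (Δ (shift t) φ) x)

  Vanishes-Δw : ∀ w {φ} → Vanishes φ → Vanishes (Δw w φ)
  Vanishes-Δw []      p∣φ = p∣φ
  Vanishes-Δw (t ∷ w) p∣φ = Vanishes-Δw w (λ x → ∣m∣n⇒∣m-n (p∣φ (shift t x)) (p∣φ x))

  Deg<-mono : ∀ {d d' φ} → d ≤ d' → Deg< d φ → Deg< d' φ
  Deg<-mono d≤d' deg w d'≤w = deg w (ℕₚ.≤-trans d≤d' d'≤w)

  Deg<-cong : ∀ {d φ ψ} → φ ≗ ψ → Deg< d φ → Deg< d ψ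
  Deg<-cong φ≗ψ deg w d≤w x = subst (+ p ∣_) (Δw-cong w φ≗ψ x) (deg w d≤w x)

  Deg<-+ : ∀ {d φ ψ} → Deg< d φ → Deg< d ψ → Deg< d (λ x → φ x + ψ x)
  Deg<-+ {φ = φ} {ψ} degφ degψ w d≤w x =
    subst (+ p ∣_) (sym (Δw-distrib-+ w φ ψ x)) (∣m∣n⇒∣m+n (degφ w d≤w x) (degψ w d≤w x))

  Deg<-∘ : ∀ {d φ τ} → Equivariant τ → Deg< d φ → Deg< d (φ ∘ τ)
  Deg<-∘ {φ = φ} τ-eq deg w d≤w x = subst (+ p ∣_) (sym (Δw-∘ w τ-eq φ x)) (deg w d≤w _)

  Deg<-Δw : ∀ {d φ} w → Deg< (weight w ℕ.+ d) φ → Deg< d (Δw w φ)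
  Deg<-Δw {d} {φ} w deg w' d≤w' x = subst (+ p ∣_) (cong (λ f → f x) (Δw-++ w w' φ))
    (deg (w ++ w') (subst (weight w ℕ.+ d ≤_) (sym (weight-++ w w')) (ℕₚ.+-monoʳ-≤ (weight w) d≤w')) x)

  Deg<-zero : ∀ {φ} → Deg< 0 φ → Vanishes φ
  Deg<-zero deg = deg [] z≤n

  Deg<-Δ : ∀ {d φ} t → Deg< (wt t ℕ.+ d) φ → Deg< d (Δ (shift t) φ)
  Deg<-Δ t deg w d≤w = deg (t ∷ w) (ℕₚ.+-monoʳ-≤ (wt t) d≤w)

  Lowers : (Point → Point) → Set
  Lowers τ = ∀ {d φ} → Deg< (suc d) φ → Deg< d (Δ τ φ)

  walk-lowers : ∀ ts → All (λ t → wt t ≡ 1) ts → Lowers (walk ts)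
  walk-lowers []       _               {φ = φ} _   w _ =
    Vanishes-Δw w (λ x → subst (+ p ∣_) (sym (ℤₚ.+-inverseʳ (φ x))) ∣0)
  walk-lowers (t ∷ ts) (wt≡1 ∷ wts≡1) {d} {φ} deg =
    Deg<-cong telescope (Deg<-+ (Deg<-∘ (λ u x → shift-comm t u x) (walk-lowers ts wts≡1 deg))
                                (Deg<-Δ t (subst (λ k → Deg< (k ℕ.+ d) φ) (sym wt≡1) deg)))
    where
    telescope : ∀ x → Δ (walk ts) φ (shift t x) + Δ (shift t) φ x ≡ Δ (walk (t ∷ ts)) φ x
    telescope x = sum-of-steps (φ (walk ts (shift t x))) (φ (shift t x)) (φ x)
      where
      sum-of-steps : ∀ a b c → (a - b) + (b - c) ≡ a - c
      sum-of-steps = solve-∀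

  Δ^-lowers : ∀ {τ} → Lowers τ → ∀ j {d φ} → Deg< (j ℕ.+ d) φ → Deg< d (Δ^ τ j φ)
  Δ^-lowers τ-lowers zero    deg = deg
  Δ^-lowers τ-lowers (suc j) {d} {φ} deg =
    τ-lowers (Δ^-lowers τ-lowers j (subst (λ k → Deg< k φ) (sym (ℕₚ.+-suc j d)) deg))

  Annihilates : (Fin R → ℕ) → Fn → Set
  Annihilates h φ = ∀ t → Vanishes (Δ^ (shift t) (h t) φ)

  Annihilates-Δ : ∀ h φ u → Annihilates h φ → Annihilates (updateAt h u ℕ.pred) (Δ (shift u) φ)
  Annihilates-Δ h φ u killed t with t ≟ u
  ... | yes refl = subst (λ j → Vanishes (Δ^ (shift u) j (Δ (shift u) φ))) (sym (updateAt-updates u h))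
                         (one-less (h u) (killed u))
    where
    one-less : ∀ k → Vanishes (Δ^ (shift u) k φ) → Vanishes (Δ^ (shift u) (ℕ.pred k) (Δ (shift u) φ))
    one-less zero    p∣ = Vanishes-Δw (u ∷ []) p∣
    one-less (suc k) p∣ x = subst (+ p ∣_) (Δ^-suc (shift u) k φ x) (p∣ x)
  ... | no  t≢u  = λ x → subst (+ p ∣_)
          (trans (sym (Δ^-comm (shift t) (shift u) (shift-comm t u) (h t) φ x))
                 (cong (λ j → Δ^ (shift t) j (Δ (shift u) φ) x) (sym (updateAt-minimal t u h t≢u))))
          (Vanishes-Δw (u ∷ []) (killed t) x)

  budget : (Fin R → ℕ) → ℕ
  budget h = ∑ R (λ t → wt t ℕ.* (h t ℕ.∸ 1))

  budget-pred : ∀ h u k → h u ≡ suc (suc k) → budget h ≡ budget (updateAt h u ℕ.pred) ℕ.+ wt u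
  budget-pred h u k hu≡ = ∑-update R _ _ u (wt u)
    (λ t t≢u → cong (λ j → wt t ℕ.* (j ℕ.∸ 1)) (sym (updateAt-minimal t u h t≢u)))
    (begin
      wt u ℕ.* (h u ℕ.∸ 1)                             ≡⟨ cong (λ j → wt u ℕ.* (j ℕ.∸ 1)) hu≡ ⟩
      wt u ℕ.* suc k                                   ≡⟨ ℕₚ.*-suc (wt u) k ⟩
      wt u ℕ.+ wt u ℕ.* k                              ≡⟨ ℕₚ.+-comm (wt u) _ ⟩
      wt u ℕ.* k ℕ.+ wt u                              ≡⟨ cong (λ j → wt u ℕ.* (j ℕ.∸ 1) ℕ.+ wt u)
                                                              (trans (updateAt-updates u h) (cong ℕ.pred hu≡)) ⟨
      wt u ℕ.* (updateAt h u ℕ.pred u ℕ.∸ 1) ℕ.+ wt u ∎)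
    where open ≡-Reasoning

  -- Pigeonhole: a word of weight > budget h contains some letter t at least h t times, and the Δₜ commute.
  annihilated⇒Deg< : ∀ h φ → Annihilates h φ → Deg< (suc (budget h)) φ
  annihilated⇒Deg< h φ killed []      ()
  annihilated⇒Deg< h φ killed (u ∷ w) long = by-multiplicity (h u) refl
    where
    h′ : Fin R → ℕ
    h′ = updateAt h u ℕ.pred
    killed′ : Annihilates h′ (Δ (shift u) φ)
    killed′ = Annihilates-Δ h φ u killed
    Δᵤφ-vanishes : ∀ {k} → h u ≡ k → ℕ.pred k ≡ 0 → Vanishes (Δ (shift u) φ)
    Δᵤφ-vanishes hu≡ pred≡0 = subst (λ j → Vanishes (Δ^ (shift u) j (Δ (shift u) φ)))
                                    (trans (updateAt-updates u h) (trans (cong ℕ.pred hu≡) pred≡0)) (killed′ u)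
    by-multiplicity : ∀ k → h u ≡ k → Vanishes (Δw w (Δ (shift u) φ))
    by-multiplicity zero          hu≡ = Vanishes-Δw w (Δᵤφ-vanishes hu≡ refl)
    by-multiplicity (suc zero)    hu≡ = Vanishes-Δw w (Δᵤφ-vanishes hu≡ refl)
    by-multiplicity (suc (suc k)) hu≡ = annihilated⇒Deg< h′ (Δ (shift u) φ) killed′ w
      (ℕₚ.+-cancelˡ-≤ (wt u) _ _ (subst (_≤ wt u ℕ.+ weight w)
        (trans (cong suc (trans (budget-pred h u k hu≡) (ℕₚ.+-comm _ (wt u)))) (sym (ℕₚ.+-suc (wt u) _))) long))

module LatticeIndicator (R : ℕ) (wt : Fin R → ℕ) {p : ℕ} (prime : Prime p) (K : Fin R → ℕ) where

  open import Data.Fin using (Fin; _≟_)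
  open import Data.Fin.Properties using (all?)
  open import Data.Integer using (ℤ; +_; _-_; 0ℤ; 1ℤ)
  open import Data.Integer.Divisibility.Signed using (_∣_)
  import Data.Integer.Properties as ℤₚ
  open import Data.Nat as ℕ using (ℕ; _^_; _+_)
  open import Data.Nat.Divisibility as ℕ∣ using (_∣?_)
  open import Data.Nat.GeneralisedArithmetic using (iterate)
  import Data.Nat.Properties as ℕₚ
  open import Data.Empty using (⊥-elim)
  open import Data.Vec using (lookup)
  open import Function using (_⇔_; mk⇔; Equivalence)
  open import Relation.Binary.PropositionalEquality
  open import Relation.Nullary using (yes; no)
  open Congruence p using (frobenius^)
  open Differences
  open Lattice R
  open WeightedDegree R wt p

  q : Fin R → ℕ
  q t = p ^ K t

  OnLattice : Point → Set
  OnLattice x = ∀ t → q t ℕ∣.∣ lookup x t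

  opaque
    δ : Point → ℤ
    δ x with all? (λ t → q t ∣? lookup x t)
    ... | yes _ = 1ℤ
    ... | no  _ = 0ℤ

    δ-on : ∀ {x} → OnLattice x → δ x ≡ 1ℤ
    δ-on {x} on with all? (λ t → q t ∣? lookup x t)
    ... | yes _   = refl
    ... | no  off = ⊥-elim (off on)

    δ≢0⇒on : ∀ {x} → δ x ≢ 0ℤ → OnLattice x
    δ≢0⇒on {x} δx≢0 with all? (λ t → q t ∣? lookup x t)
    ... | yes on = on
    ... | no  _  = ⊥-elim (δx≢0 refl)

    δ-cong : ∀ {x y} → OnLattice x ⇔ OnLattice y → δ x ≡ δ y
    δ-cong {x} {y} x⇔y with all? (λ t → q t ∣? lookup x t) | all? (λ t → q t ∣? lookup y t)
    ... | yes _    | yes _    = refl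
    ... | no  _    | no  _    = refl
    ... | yes x-on | no  y-off = ⊥-elim (y-off (Equivalence.to x⇔y x-on))
    ... | no  x-off | yes y-on = ⊥-elim (x-off (Equivalence.from x⇔y y-on))

  δ-periodic : ∀ t x → δ (iterate (shift t) x (q t)) ≡ δ x
  δ-periodic t x = δ-cong (mk⇔ (λ on u → ⇒ u (on u)) (λ on u → ⇐ u (on u)))
    where
    ⇒ : ∀ u → q u ℕ∣.∣ lookup (iterate (shift t) x (q t)) u → q u ℕ∣.∣ lookup x u
    ⇒ u q∣ with u ≟ t
    ... | yes refl = ℕ∣.∣m+n∣m⇒∣n (subst (q u ℕ∣.∣_) (trans (lookup-iterate-shift u (q u) x) (ℕₚ.+-comm _ (q u))) q∣)
                                   ℕ∣.∣-refl
    ... | no  u≢t  = subst (q u ℕ∣.∣_) (lookup-iterate-shift′ t (q t) x u u≢t) q∣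
    ⇐ : ∀ u → q u ℕ∣.∣ lookup x u → q u ℕ∣.∣ lookup (iterate (shift t) x (q t)) u
    ⇐ u q∣ with u ≟ t
    ... | yes refl = subst (q u ℕ∣.∣_) (sym (lookup-iterate-shift u (q u) x)) (ℕ∣.∣m∣n⇒∣m+n q∣ ℕ∣.∣-refl)
    ... | no  u≢t  = subst (q u ℕ∣.∣_) (sym (lookup-iterate-shift′ t (q t) x u u≢t)) q∣

  -- Δₜ^{p^{K t}} ≡ (shift by p^{K t}) − id (mod p), and δ is invariant under that shift.
  δ-Deg< : Deg< (ℕ.suc (budget q)) δ
  δ-Deg< = annihilated⇒Deg< q δ killed
    where
    killed : Annihilates q δ
    killed t x = subst (+ p ∣_)
      (trans (cong (λ d → Δ^ (shift t) (q t) δ x - (d - δ x)) (δ-periodic t x))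
             (trans (cong (Δ^ (shift t) (q t) δ x -_) (ℤₚ.+-inverseʳ (δ x))) (ℤₚ.+-identityʳ _)))
      (frobenius^ prime (K t) (shift t) δ x)

module LinearAlgebra {p : ℕ} (prime : Prime p) where

  open import Data.Fin using (Fin; zero; suc; punchIn)
  open import Data.Fin.Properties using (any?)
  open import Data.Integer
    hiding (suc; _≤_; _<_; _≥_; _>_; _≤?_; _<?_; _≟_)
  open import Data.Integer.Divisibility.Signed using (_∣_; _∣?_; ∣m⇒∣m*n)
  import Data.Integer.Properties as ℤₚ
  open import Data.Integer.Tactic.RingSolver using (solve-∀)
  open import Data.Empty using (⊥-elim)
  open import Data.Nat using (ℕ; zero; suc)
  open import Data.Product using (Σ; _×_; _,_)
  open import Data.Vec.Functional using (insertAt)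
  open import Data.Vec.Functional.Properties using (insertAt-lookup; insertAt-punchIn)
  open import Function using (_∘_)
  open import Relation.Binary.PropositionalEquality
  open import Relation.Nullary using (¬_; ¬?; yes; no)
  open import Algebra.Properties.Semiring.Sum ℤₚ.+-*-semiring
    using (sum-syntax; sum-cong-≗; sum-remove; ∑-distrib-+; *-distribˡ-sum)
  open Congruence p using (∣0; ∣-sum; ∤-*; ∤1)

  infix 7 _·_
  _·_ : ∀ {n} → (Fin n → ℤ) → (Fin n → ℤ) → ℤ
  u · v = ∑[ j < _ ] (u j * v j)

  ·-linearˡ : ∀ {n} α β (u w v : Fin n → ℤ) → (λ j → α * u j + β * w j) · v ≡ α * (u · v) + β * (w · v)
  ·-linearˡ {n} α β u w v = begin
    ∑[ j < n ] ((α * u j + β * w j) * v j)        ≡⟨ sum-cong-≗ {n} (λ j → distribute α β (u j) (w j) (v j)) ⟩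
    ∑[ j < n ] (α * (u j * v j) + β * (w j * v j)) ≡⟨ ∑-distrib-+ {n} (λ j → α * (u j * v j)) (λ j → β * (w j * v j)) ⟩
    ∑[ j < n ] (α * (u j * v j)) + ∑[ j < n ] (β * (w j * v j))
      ≡⟨ cong₂ _+_ (*-distribˡ-sum {n} α (λ j → u j * v j)) (*-distribˡ-sum {n} β (λ j → w j * v j)) ⟨
    α * (u · v) + β * (w · v)                      ∎
    where
    open ≡-Reasoning
    distribute : ∀ α β u w v → (α * u + β * w) * v ≡ α * (u * v) + β * (w * v)
    distribute = solve-∀

  ·-scaleʳ : ∀ {n} m (u v : Fin n → ℤ) → u · (λ j → m * v j) ≡ m * (u · v)
  ·-scaleʳ {n} m u v = trans (sum-cong-≗ {n} (λ j → commute m (u j) (v j))) (sym (*-distribˡ-sum {n} m (λ j → u j * v j)))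
    where
    commute : ∀ m u v → u * (m * v) ≡ m * (u * v)
    commute = solve-∀

  ·-insertAt : ∀ {n} (u : Fin (suc n) → ℤ) v k x → u · insertAt v k x ≡ u k * x + (u ∘ punchIn k) · v
  ·-insertAt {n} u v k x = trans (sum-remove {n} {k} (λ j → u j * insertAt v k x j))
    (cong₂ (λ a b → u k * a + b) (insertAt-lookup v k x)
                                 (sum-cong-≗ {n} (λ j → cong (u (punchIn k j) *_) (insertAt-punchIn v k x j))))

  Nontrivial : ∀ {n} → (Fin n → ℤ) → Set
  Nontrivial {n} c = Σ (Fin n) λ j → ¬ + p ∣ c j

  -- Row operations with pivot M zero k; column k, which they clear, is dropped.
  clearColumn : ∀ {s} → (Fin (suc s) → Fin (suc (suc s)) → ℤ) → Fin (suc (suc s)) → Fin s → Fin (suc s) → ℤ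
  clearColumn M k i j = M zero k * M (suc i) (punchIn k j) + (- M (suc i) k) * M zero (punchIn k j)

  kernelVector : ∀ s (M : Fin s → Fin (suc s) → ℤ) →
                 Σ (Fin (suc s) → ℤ) λ c → Nontrivial c × (∀ i → + p ∣ M i · c)
  kernelVector zero M = (λ _ → 1ℤ) , (zero , ∤1 prime) , λ ()
  kernelVector (suc s) M with any? (λ j → ¬? (+ p ∣? M zero j))
  kernelVector (suc s) M | no no-pivot with kernelVector s (λ i → M (suc i) ∘ suc)
  ... | c′ , (j₀ , p∤c′j₀) , rows′ = insertAt c′ zero 0ℤ , (suc j₀ , p∤c′j₀) , rows
    where
    rows : ∀ i → + p ∣ M i · insertAt c′ zero 0ℤ
    rows zero    = ∣-sum (suc (suc s)) _ λ j → ∣m⇒∣m*n (insertAt c′ zero 0ℤ j) (p∣M₀ j)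
      where
      p∣M₀ : ∀ j → + p ∣ M zero j
      p∣M₀ j with + p ∣? M zero j
      ... | yes p∣ = p∣
      ... | no  p∤ = ⊥-elim (no-pivot (j , p∤))
    rows (suc i) = subst (+ p ∣_) (sym (trans (·-insertAt (M (suc i)) c′ zero 0ℤ)
                                            (trans (cong (_+ (M (suc i) ∘ suc) · c′) (ℤₚ.*-zeroʳ (M (suc i) zero)))
                                                   (ℤₚ.+-identityˡ _))))
                          (rows′ i)
  kernelVector (suc s) M | yes (k , p∤m) with kernelVector s (clearColumn M k)
  ... | c′ , (j₀ , p∤c′j₀) , rows′ = c , (punchIn k j₀ , p∤cⱼ₀) , rows
    where
    m S : ℤ
    m = M zero k
    S = (M zero ∘ punchIn k) · c′
    c : Fin (suc (suc s)) → ℤ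
    c = insertAt (λ j → m * c′ j) k (- S)
    p∤cⱼ₀ : ¬ + p ∣ c (punchIn k j₀)
    p∤cⱼ₀ = subst (λ x → ¬ + p ∣ x) (sym (insertAt-punchIn (λ j → m * c′ j) k (- S) j₀))
                  (∤-* prime p∤m p∤c′j₀)
    eliminate : ∀ row → row · c ≡ m * ((row ∘ punchIn k) · c′) + (- row k) * S
    eliminate row = trans (·-insertAt row (λ j → m * c′ j) k (- S))
                          (trans (cong (_+_ (row k * - S)) (·-scaleʳ m (row ∘ punchIn k) c′))
                                 (swap (row k) S (m * ((row ∘ punchIn k) · c′))))
      where
      swap : ∀ a S t → a * - S + t ≡ t + (- a) * S
      swap = solve-∀
    rows : ∀ i → + p ∣ M i · c
    rows zero    = subst (+ p ∣_) (sym (trans (eliminate (M zero)) (cancel m S))) ∣0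
      where
      cancel : ∀ m S → m * S + (- m) * S ≡ 0ℤ
      cancel = solve-∀
    rows (suc i) = subst (+ p ∣_) (sym (trans (eliminate (M (suc i)))
                                             (sym (·-linearˡ m (- M (suc i) k) (M (suc i) ∘ punchIn k) (M zero ∘ punchIn k) c′))))
                          (rows′ i)

module LinearFactors where

  open import Data.Fin using (Fin; zero; suc)
  open import Data.Integer
    hiding (suc; _≤_; _<_; _≥_; _>_; _≤?_; _<?_; _≟_)
  import Data.Integer.Properties as ℤₚ
  open import Data.Integer.Tactic.RingSolver using (solve-∀)
  open import Data.Nat as ℕ using (ℕ; zero; suc)
  import Data.Nat.Properties as ℕₚ
  open import Data.Product using (_,_)
  open import Function using (_∘_)
  open import Relation.Binary.PropositionalEquality
  open Differences

  Killed : ℕ → (ℕ → ℤ) → Set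
  Killed d f = ∀ y → Δ^ suc d f y ≡ 0ℤ

  Killed-mono : ∀ {d j f} → d ℕ.≤ j → Killed d f → Killed j f
  Killed-mono {d} {j} {f} d≤j killed y with ℕₚ.m≤n⇒∃[o]m+o≡n d≤j
  ... | o , refl = trans (cong (λ k → Δ^ suc k f y) (ℕₚ.+-comm d o))
                         (trans (cong (λ g → g y) (Δ^-+ suc o d f)) (Δ^-zero suc o killed y))

  Killed-linearFactor : ∀ d f b → Killed d f → Killed (suc d) (λ x → (+ x - + b) * f x)
  Killed-linearFactor zero f b killed y =
    cong₂ _-_ (trans (cong (λ z → (+ suc y - + b) * z) (killed (suc y))) (ℤₚ.*-zeroʳ (+ suc y - + b)))
              (trans (cong (λ z → (+ y - + b) * z) (killed y)) (ℤₚ.*-zeroʳ (+ y - + b)))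
  Killed-linearFactor (suc d) f b killed y = begin
    Δ^ suc (suc (suc d)) g y                                   ≡⟨ Δ^-suc suc (suc d) g y ⟩
    Δ^ suc (suc d) (Δ suc g) y                                 ≡⟨ Δ^-cong suc (suc d) product-rule y ⟩
    Δ^ suc (suc d) (λ x → (+ x - + b) * Δ suc f x + f (suc x)) y
      ≡⟨ Δ^-distrib-+ suc (suc d) (λ x → (+ x - + b) * Δ suc f x) (f ∘ suc) y ⟩
    Δ^ suc (suc d) (λ x → (+ x - + b) * Δ suc f x) y + Δ^ suc (suc d) (f ∘ suc) y
      ≡⟨ cong₂ _+_ (Killed-linearFactor d (Δ suc f) b (λ z → trans (sym (Δ^-suc suc d f z)) (killed z)) y)
                   (trans (Δ^-∘ suc suc (λ _ → refl) (suc d) f y) (killed (suc y))) ⟩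
    0ℤ ∎
    where
    open ≡-Reasoning
    g : ℕ → ℤ
    g x = (+ x - + b) * f x
    product-rule : ∀ x → Δ suc g x ≡ (+ x - + b) * Δ suc f x + f (suc x)
    product-rule x = trans (cong (λ z → (z - + b) * f (suc x) - (+ x - + b) * f x) (ℤₚ.pos-+ 1 x))
                           (expand (+ x) (+ b) (f (suc x)) (f x))
      where
      expand : ∀ x b f₁ f₀ → (+ 1 + x - b) * f₁ - (x - b) * f₀ ≡ (x - b) * (f₁ - f₀) + f₁
      expand = solve-∀

  linearFactors : ∀ n → (Fin n → ℕ) → ℕ → ℤ
  linearFactors zero    g x = 1ℤ
  linearFactors (suc n) g x = (+ x - + g zero) * linearFactors n (g ∘ suc) x

  Killed-linearFactors : ∀ n g → Killed (suc n) (linearFactors n g)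
  Killed-linearFactors zero    g y = ℤₚ.+-inverseʳ 1ℤ
  Killed-linearFactors (suc n) g = Killed-linearFactor (suc n) _ (g zero) (Killed-linearFactors n (g ∘ suc))

  linearFactors-root : ∀ n g (i : Fin n) → linearFactors n g (g i) ≡ 0ℤ
  linearFactors-root (suc n) g zero    = trans (cong (_* linearFactors n (g ∘ suc) (g zero)) (ℤₚ.+-inverseʳ (+ g zero)))
                                               (ℤₚ.*-zeroˡ (linearFactors n (g ∘ suc) (g zero)))
  linearFactors-root (suc n) g (suc i) = trans (cong (λ z → (+ g (suc i) - + g zero) * z) (linearFactors-root n (g ∘ suc) i))
                                               (ℤₚ.*-zeroʳ (+ g (suc i) - + g zero))


module Weights {p : ℕ} (prime : Prime p) where

  open import Data.Fin using (Fin; zero; suc; toℕ; punchIn; fromℕ<)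
  open import Data.Fin.Properties using (punchInᵢ≢i; toℕ-fromℕ<)
  open import Data.Integer
    hiding (suc; _≤_; _<_; _≥_; _>_; _≤?_; _<?_; _≟_)
  open import Data.Integer.Divisibility.Signed using (_∣_; ∣m+n∣m⇒∣n; ∣n⇒∣m*n)
  import Data.Integer.Properties as ℤₚ
  open import Data.Nat as ℕ using (ℕ; zero; suc)
  open import Data.Nat.Combinatorics using (_C_)
  open import Data.Nat.GeneralisedArithmetic using (iterate; iterate-is-fold; id-is-fold)
  import Data.Nat.Properties as ℕₚ
  open import Data.Product using (Σ; _×_; _,_)
  open import Function using (_∘_)
  open import Relation.Binary.PropositionalEquality
  open import Relation.Nullary using (¬_)
  open import Algebra.Properties.Semiring.Sum ℤₚ.+-*-semiring
    using (sum-syntax; sum-cong-≗; sum-remove; sum-replicate-zero)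
  open Differences
  open Congruence p using (∣0; ∤-*; ∤1; ∣*∤⇒∣; lowMoments⇒∣weightedSum)
  open LinearAlgebra prime using (kernelVector)
  open LinearFactors

  linearFactors-∤ : ∀ n g x → (∀ i → ¬ + p ∣ + x - + g i) → ¬ + p ∣ linearFactors n g x
  linearFactors-∤ zero    g x p∤ = ∤1 prime
  linearFactors-∤ (suc n) g x p∤ = ∤-* prime (p∤ zero) (linearFactors-∤ n (g ∘ suc) x (p∤ ∘ suc))

  DistinctMod : ∀ {s} → (Fin s → ℕ) → Set
  DistinctMod a = ∀ i k → i ≢ k → ¬ + p ∣ + a i - + a k

  nodes : ∀ {s} → (Fin s → ℕ) → Fin (suc s) → ℕ
  nodes a zero    = 0
  nodes a (suc i) = a i

  LowMoments : ∀ {s} → (Fin s → ℕ) → (Fin (suc s) → ℤ) → Set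
  LowMoments {s} a c = ∀ j → j ℕ.< s → + p ∣ ∑[ i < suc s ] (+ (nodes a i C j) * c i)

  -- Test the moment conditions against the polynomial ∏_{i ≠ k} (x − aᵢ) of degree s − 1.
  LowMoments⇒∣tail : ∀ s (a : Fin s → ℕ) B → (∀ i → a i ℕ.< B) → DistinctMod a →
                     ∀ c → LowMoments a c → + p ∣ c zero → ∀ k → + p ∣ c (suc k)
  LowMoments⇒∣tail (suc s) a B a<B distinct c low p∣c₀ k = ∣*∤⇒∣ prime p∣c·F (linearFactors-∤ s _ (a k) p∤)
    where
    F : ℕ → ℤ
    F = linearFactors s (a ∘ punchIn k)
    p∤ : ∀ j → ¬ + p ∣ + a k - + a (punchIn k j)
    p∤ j = distinct k (punchIn k j) (punchInᵢ≢i k j ∘ sym)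
    high : ∀ j → suc s ℕ.≤ j → + p ∣ Δ^ suc j F 0
    high j s<j = subst (+ p ∣_) (sym (Killed-mono s<j (Killed-linearFactors s _) 0)) ∣0
    low′ : ∀ j → j ℕ.< suc s → + p ∣ ∑[ i < suc s ] (+ (a i C j) * c (suc i))
    low′ j j<s = ∣m+n∣m⇒∣n (low j j<s) (∣n⇒∣m*n (+ (0 C j)) p∣c₀)
    iterate-suc : ∀ n → iterate suc 0 n ≡ n
    iterate-suc n = trans (sym (iterate-is-fold 0 suc n)) (id-is-fold n)
    only-k : ∑[ i < suc s ] (c (suc i) * F (iterate suc 0 (a i))) ≡ c (suc k) * F (a k)
    only-k = begin
      ∑[ i < suc s ] (c (suc i) * F (iterate suc 0 (a i)))
        ≡⟨ sum-cong-≗ {suc s} (λ i → cong (λ x → c (suc i) * F x) (iterate-suc (a i))) ⟩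
      ∑[ i < suc s ] (c (suc i) * F (a i))
        ≡⟨ sum-remove {s} {k} (λ i → c (suc i) * F (a i)) ⟩
      c (suc k) * F (a k) + ∑[ j < s ] (c (suc (punchIn k j)) * F (a (punchIn k j)))
        ≡⟨ cong (_+_ (c (suc k) * F (a k))) (trans (sum-cong-≗ {s} (λ j →
             trans (cong (c (suc (punchIn k j)) *_) (linearFactors-root s (a ∘ punchIn k) j))
                   (ℤₚ.*-zeroʳ (c (suc (punchIn k j))))))
             (sum-replicate-zero s)) ⟩
      c (suc k) * F (a k) + 0ℤ
        ≡⟨ ℤₚ.+-identityʳ _ ⟩
      c (suc k) * F (a k) ∎
      where open ≡-Reasoning
    p∣c·F : + p ∣ c (suc k) * F (a k)
    p∣c·F = subst (+ p ∣_) only-k (lowMoments⇒∣weightedSum suc F 0 B (suc s) a (c ∘ suc) (ℕₚ.<⇒≤ ∘ a<B) high low′)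

  weights : ∀ s (a : Fin s → ℕ) B → (∀ i → a i ℕ.< B) → DistinctMod a →
            Σ (Fin (suc s) → ℤ) λ c → ¬ + p ∣ c zero × LowMoments a c
  weights s a B a<B distinct with kernelVector s (λ j i → + (nodes a i C toℕ j))
  ... | c , (j₀ , p∤cⱼ₀) , rows = c , p∤c₀ , low
    where
    low : LowMoments a c
    low j j<s = subst (λ t → + p ∣ ∑[ i < suc s ] (+ (nodes a i C t) * c i)) (toℕ-fromℕ< j<s) (rows (fromℕ< j<s))
    p∤c₀ : ¬ + p ∣ c zero
    p∤c₀ p∣c₀ = p∣-everywhere j₀ p∤cⱼ₀
      where
      p∣-everywhere : ∀ j → ¬ ¬ + p ∣ c j
      p∣-everywhere zero    p∤ = p∤ p∣c₀
      p∣-everywhere (suc k) p∤ = p∤ (LowMoments⇒∣tail s a B a<B distinct c low p∣c₀ k)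

module WeightedZeroSums {p : ℕ} (prime : Prime p) (n : ℕ) (ks : Fin (suc n) → ℕ) (k : ℕ)
                        {s : ℕ} (a : Fin s → ℕ) (B : ℕ) (a<B : ∀ i → a i < B)
                        (distinct : Weights.DistinctMod prime a) where

  open import Data.Bool using (Bool; true; false; if_then_else_)
  open import Data.Fin using (Fin; zero; suc)
  open import Data.Fin.Subset using (Subset; ∣_∣; _∈_)
  open import Data.Integer
    hiding (suc; _≤_; _<_; _≥_; _>_; _≤?_; _<?_; _≟_; ∣_∣)
  open import Data.Integer.Divisibility.Signed using (_∣_; _∣?_; ∣m∣n⇒∣m-n; ∣n⇒∣m*n; ∣m∣n⇒∣m+n)
  import Data.Integer.Properties as ℤₚ
  open import Data.Integer.Tactic.RingSolver using (solve-∀)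
  open import Data.Empty using (⊥-elim)
  open import Data.List using (map)
  open import Data.List.Relation.Unary.All.Properties using (map⁺)
  import Data.List.Relation.Unary.All as All
  open import Data.Nat as ℕ using (ℕ; zero; suc; z≤n)
  open import Data.Nat.Divisibility as ℕ∣ using ()
  import Data.Nat.Properties as ℕₚ
  open import Data.Nat.GeneralisedArithmetic using (iterate)
  open import Data.Product using (Σ; _×_; _,_; proj₁; proj₂)
  open import Data.Vec as Vec using (Vec; []; _∷_; lookup)
  open import Data.Vec.Properties using (lookup-replicate; []=⇒lookup; lookup-map)
  open import Defs using (Elem; wsum; dStar; IsZeroG)
  open import Function using (_∘_)
  open import Relation.Binary.PropositionalEquality
  open import Relation.Nullary using (¬_; yes; no)
  open import Algebra.Properties.Semiring.Sum ℤₚ.+-*-semiring using (sum-syntax; sum-cong-≗)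
  open Differences
  open Congruence p using (Vanishes; ∣0; lowMoments⇒∣weightedSum; ∤-sum⇒∤-term; ∤-^)
  open Occurrences using (word; count; count-map-suc; count-zero-map-suc; count-word)
  open Weights prime using (weights; nodes; LowMoments)

  -- Coordinate zero records the length of a subsequence modulo p^k, and coordinate
  -- suc t its weighted sum in the cyclic factor ℤ/p^{ks t}.
  R : ℕ
  R = suc (suc n)

  wt : Fin R → ℕ
  wt zero    = s
  wt (suc _) = 1

  K : Fin R → ℕ
  K zero    = k
  K (suc t) = ks t

  open Lattice R
  open WeightedDegree R wt p
  open LatticeIndicator R wt prime K

  opaque
    c : Fin (suc s) → ℤ
    c = proj₁ (weights s a B a<B distinct)

    p∤c₀ : ¬ + p ∣ c zero
    p∤c₀ = proj₁ (proj₂ (weights s a B a<B distinct))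

    c-moments : LowMoments a c
    c-moments = proj₂ (proj₂ (weights s a B a<B distinct))

  translate : Elem (suc n) → Point → Point
  translate g = walk (map suc (word g))

  -- Skip g (i = zero), or append it with weight a i.
  move : Elem (suc n) → Fin (suc s) → Point → Point
  move g zero    x = x
  move g (suc i) x = iterate (translate g) (shift zero x) (a i)

  T : Elem (suc n) → Fn → Fn
  T g φ x = ∑[ i < suc s ] (c i * φ (move g i x))

  translate-lowers : ∀ g → Lowers (translate g)
  translate-lowers g = walk-lowers (map suc (word g)) (map⁺ (All.universal (λ _ → refl) (word g)))

  move-equivariant : ∀ g i → Equivariant (move g i)
  move-equivariant g zero    t x = refl
  move-equivariant g (suc i) t x =
    trans (cong (λ y → iterate (translate g) y (a i)) (shift-comm zero t x))
          (iterate-comm (translate g) (shift t) (λ y → walk-shift (map suc (word g)) t y) (shift zero x) (a i))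

  -- Newton's formula along translate g: c kills the differences of order < s, and χ those of order ≥ s.
  T-kills : ∀ g χ → Deg< s χ → Vanishes (T g χ)
  T-kills g χ deg x = subst (+ p ∣_) (sym T≡) (∣m∣n⇒∣m-n p∣moments (∣n⇒∣m*n (c zero) p∣Δ₀χ))
    where
    y : Point
    y = shift zero x
    tail : ℤ
    tail = ∑[ i < s ] (c (suc i) * χ (iterate (translate g) y (a i)))
    T≡ : T g χ x ≡ (c zero * χ y + tail) - c zero * (χ y - χ x)
    T≡ = rearrange (c zero) (χ x) (χ y) tail
      where
      rearrange : ∀ c₀ u v t → c₀ * u + t ≡ (c₀ * v + t) - c₀ * (v - u)
      rearrange = solve-∀
    p∣Δ₀χ : + p ∣ χ y - χ x
    p∣Δ₀χ = Deg<-zero (Deg<-Δ zero (Deg<-mono (ℕₚ.≤-reflexive (sym (ℕₚ.+-identityʳ s))) deg)) x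
    high : ∀ j → s ℕ.≤ j → + p ∣ Δ^ (translate g) j χ y
    high j s≤j = Deg<-zero (Δ^-lowers (translate-lowers g) j
                             (Deg<-mono (ℕₚ.≤-trans s≤j (ℕₚ.≤-reflexive (sym (ℕₚ.+-identityʳ j)))) deg)) y
    node≤B : ∀ i → nodes a i ℕ.≤ B
    node≤B zero    = z≤n
    node≤B (suc i) = ℕₚ.<⇒≤ (a<B i)
    p∣moments : + p ∣ c zero * χ y + tail
    p∣moments = lowMoments⇒∣weightedSum (translate g) χ y B s (nodes a) c node≤B high c-moments

  T-lowers : ∀ g d φ → Deg< (d ℕ.+ s) φ → Deg< d (T g φ)
  T-lowers g d φ deg w d≤w x =
    subst (+ p ∣_) (sym commute) (T-kills g (Δw w φ) (Deg<-Δw w (Deg<-mono (ℕₚ.+-monoˡ-≤ s d≤w) deg)) x)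
    where
    commute : Δw w (T g φ) x ≡ T g (Δw w φ) x
    commute = begin
      Δw w (T g φ) x                                          ≡⟨ Δw-distrib-sum w (λ i y → c i * φ (move g i y)) x ⟩
      ∑[ i < suc s ] Δw w (λ y → c i * φ (move g i y)) x     ≡⟨ sum-cong-≗ {suc s}
                                                                   (λ i → trans (Δw-distrib-* w (c i) (φ ∘ move g i) x)
                                                                                (cong (c i *_) (Δw-∘ w (move-equivariant g i) φ x))) ⟩
      T g (Δw w φ) x                                          ∎
      where open ≡-Reasoning

  Tδ : ∀ m → (Fin m → Elem (suc n)) → Fn
  Tδ zero    gs = δ
  Tδ (suc m) gs = T (gs zero) (Tδ m (gs ∘ suc))

  Tδ-Deg< : ∀ m gs d → Deg< (d ℕ.+ m ℕ.* s) δ → Deg< d (Tδ m gs)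
  Tδ-Deg< zero    gs d deg = subst (λ e → Deg< e δ) (ℕₚ.+-identityʳ d) deg
  Tδ-Deg< (suc m) gs d deg = T-lowers (gs zero) d (Tδ m (gs ∘ suc))
    (Tδ-Deg< m (gs ∘ suc) (d ℕ.+ s) (subst (λ e → Deg< e δ) (sym (ℕₚ.+-assoc d s (m ℕ.* s))) deg))

  Tδ-vanishes : ∀ m gs → suc (budget q) ℕ.≤ m ℕ.* s → Vanishes (Tδ m gs)
  Tδ-vanishes m gs long = Deg<-zero (Tδ-Deg< m gs 0 (Deg<-mono long δ-Deg<))

  Choice : ℕ → Set
  Choice m = Vec (Fin (suc s)) m

  endpoint : ∀ {m} → Choice m → (Fin m → Elem (suc n)) → Point → Point
  endpoint []      gs y = y
  endpoint (i ∷ ι) gs y = endpoint ι (gs ∘ suc) (move (gs zero) i y)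

  taken : Fin (suc s) → Bool
  taken zero    = false
  taken (suc _) = true

  selected : ∀ {m} → Choice m → Subset m
  selected = Vec.map taken

  -- Tδ m gs y = Σ_ι (∏ⱼ c (ι j)) δ (endpoint ι gs y).
  Tδ-support : ∀ m gs y → ¬ + p ∣ Tδ m gs y → Σ (Choice m) λ ι → δ (endpoint ι gs y) ≢ 0ℤ
  Tδ-support zero    gs y p∤ = [] , λ δ≡0 → p∤ (subst (+ p ∣_) (sym δ≡0) ∣0)
  Tδ-support (suc m) gs y p∤ with ∤-sum⇒∤-term (suc s) (λ i → c i * Tδ m (gs ∘ suc) (move (gs zero) i y)) p∤
  ... | i , p∤term with Tδ-support m (gs ∘ suc) (move (gs zero) i y) (p∤term ∘ ∣n⇒∣m*n (c i))
  ...   | ι , δ≢0 = i ∷ ι , δ≢0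

  -- The choice ι = (zero, …, zero) contributes c zero ^ m * δ y.
  Tδ-support⁺ : ∀ m gs y → ¬ + p ∣ Tδ m gs y - c zero ^ m * δ y →
                 Σ (Choice m) λ ι → 1 ℕ.≤ ∣ selected ι ∣ × δ (endpoint ι gs y) ≢ 0ℤ
  Tδ-support⁺ zero    gs y p∤ =
    ⊥-elim (p∤ (subst (+ p ∣_) (sym (trans (cong (_-_ (δ y)) (ℤₚ.*-identityˡ (δ y))) (ℤₚ.+-inverseʳ (δ y)))) ∣0))
  Tδ-support⁺ (suc m) gs y p∤ with + p ∣? Tδ m (gs ∘ suc) y - c zero ^ m * δ y
  ... | no p∤′ with Tδ-support⁺ m (gs ∘ suc) y p∤′
  ...   | ι , nonempty , δ≢0 = zero ∷ ι , nonempty , δ≢0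
  Tδ-support⁺ (suc m) gs y p∤ | yes p∣′
    with ∤-sum⇒∤-term s (λ i → c (suc i) * Tδ m (gs ∘ suc) (move (gs zero) (suc i) y)) p∤tail
    where
    tail : ℤ
    tail = ∑[ i < s ] (c (suc i) * Tδ m (gs ∘ suc) (move (gs zero) (suc i) y))
    split : ∀ c₀ t u d r → c₀ * t + r - c₀ * u * d ≡ c₀ * (t - u * d) + r
    split = solve-∀
    p∤tail : ¬ + p ∣ tail
    p∤tail p∣tail = p∤ (subst (+ p ∣_) (sym (split (c zero) (Tδ m (gs ∘ suc) y) (c zero ^ m) (δ y) tail))
                                (∣m∣n⇒∣m+n (∣n⇒∣m*n (c zero) p∣′) p∣tail))
  ... | i , p∤term with Tδ-support m (gs ∘ suc) (move (gs zero) (suc i) y) (p∤term ∘ ∣n⇒∣m*n (c (suc i)))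
  ...   | ι , δ≢0 = suc i ∷ ι , ℕ.s≤s z≤n , δ≢0

  origin : Point
  origin = Vec.replicate R 0

  nontrivialChoice : ∀ m gs → suc (budget q) ℕ.≤ m ℕ.* s →
                     Σ (Choice m) λ ι → 1 ℕ.≤ ∣ selected ι ∣ × OnLattice (endpoint ι gs origin)
  nontrivialChoice m gs long with Tδ-support⁺ m gs origin p∤
    where
    δ-origin : δ origin ≡ 1ℤ
    δ-origin = δ-on (λ t → subst (q t ℕ∣.∣_) (sym (lookup-replicate t 0)) (ℕ∣._∣0 (q t)))
    p∤ : ¬ + p ∣ Tδ m gs origin - c zero ^ m * δ origin
    p∤ p∣ = ∤-^ prime p∤c₀ m
      (subst (+ p ∣_) (trans (cancel (Tδ m gs origin) (c zero ^ m * δ origin))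
                             (trans (cong (c zero ^ m *_) δ-origin) (ℤₚ.*-identityʳ (c zero ^ m))))
             (∣m∣n⇒∣m-n (Tδ-vanishes m gs long origin) p∣))
      where
      cancel : ∀ t u → t - (t - u) ≡ u
      cancel = solve-∀
  ... | ι , nonempty , δ≢0 = ι , nonempty , δ≢0⇒on δ≢0

  weightsOf : ∀ {m} → Choice m → Fin m → ℕ
  weightsOf ι j = nodes a (Vec.lookup ι j)

  lookup-move-zero : ∀ g i y → lookup (move g i y) zero ≡ lookup y zero ℕ.+ (if taken i then 1 else 0)
  lookup-move-zero g zero    y = sym (ℕₚ.+-identityʳ _)
  lookup-move-zero g (suc i) y = begin
    lookup (iterate (translate g) (shift zero y) (a i)) zero
      ≡⟨ lookup-iterate-walk (map suc (word g)) (a i) (shift zero y) zero ⟩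
    lookup (shift zero y) zero ℕ.+ a i ℕ.* count zero (map suc (word g))
      ≡⟨ cong₂ ℕ._+_ (lookup-shift zero y zero) (trans (cong (a i ℕ.*_) (count-zero-map-suc (word g))) (ℕₚ.*-zeroʳ (a i))) ⟩
    lookup y zero ℕ.+ 1 ℕ.+ 0
      ≡⟨ ℕₚ.+-identityʳ _ ⟩
    lookup y zero ℕ.+ 1 ∎
    where open ≡-Reasoning

  lookup-move-suc : ∀ g i y t → lookup (move g i y) (suc t) ≡ lookup y (suc t) ℕ.+ (if taken i then nodes a i ℕ.* g t else 0)
  lookup-move-suc g zero    y t = sym (ℕₚ.+-identityʳ _)
  lookup-move-suc g (suc i) y t = begin
    lookup (iterate (translate g) (shift zero y) (a i)) (suc t)
      ≡⟨ lookup-iterate-walk (map suc (word g)) (a i) (shift zero y) (suc t) ⟩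
    lookup (shift zero y) (suc t) ℕ.+ a i ℕ.* count (suc t) (map suc (word g))
      ≡⟨ cong₂ ℕ._+_ (trans (lookup-shift zero y (suc t)) (ℕₚ.+-identityʳ _))
                     (cong (a i ℕ.*_) (trans (count-map-suc t (word g)) (count-word g t))) ⟩
    lookup y (suc t) ℕ.+ a i ℕ.* g t ∎
    where open ≡-Reasoning

  lookup-endpoint-zero : ∀ {m} (ι : Choice m) gs y → lookup (endpoint ι gs y) zero ≡ lookup y zero ℕ.+ ∣ selected ι ∣
  lookup-endpoint-zero []      gs y = sym (ℕₚ.+-identityʳ _)
  lookup-endpoint-zero (i ∷ ι) gs y =
    trans (lookup-endpoint-zero ι (gs ∘ suc) (move (gs zero) i y))
          (trans (cong (ℕ._+ ∣ selected ι ∣) (lookup-move-zero (gs zero) i y))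
                 (trans (ℕₚ.+-assoc (lookup y zero) _ _) (cong (lookup y zero ℕ.+_) (card-cons i))))
    where
    card-cons : ∀ i → (if taken i then 1 else 0) ℕ.+ ∣ selected ι ∣ ≡ ∣ taken i ∷ selected ι ∣
    card-cons zero    = refl
    card-cons (suc i) = refl

  lookup-endpoint-suc : ∀ {m} (ι : Choice m) gs y t →
    lookup (endpoint ι gs y) (suc t) ≡ lookup y (suc t) ℕ.+ wsum (suc n) m (selected ι) (weightsOf ι) gs t
  lookup-endpoint-suc []      gs y t = sym (ℕₚ.+-identityʳ _)
  lookup-endpoint-suc (i ∷ ι) gs y t =
    trans (lookup-endpoint-suc ι (gs ∘ suc) (move (gs zero) i y) t)
          (trans (cong (ℕ._+ _) (lookup-move-suc (gs zero) i y t)) (ℕₚ.+-assoc (lookup y (suc t)) _ _))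

  budget≡ : budget q ≡ s ℕ.* (p ℕ.^ k ℕ.∸ 1) ℕ.+ dStar p (suc n) ks
  budget≡ = cong (s ℕ.* (p ℕ.^ k ℕ.∸ 1) ℕ.+_)
                 (NatSums.∑-cong (suc n) (λ t → ℕₚ.*-identityˡ (p ℕ.^ ks t ℕ.∸ 1)))

  selected⇒node : ∀ {m} (ι : Choice m) i → i ∈ selected ι → Σ (Fin s) λ j → weightsOf ι i ≡ a j
  selected⇒node ι i i∈S with Vec.lookup ι i | trans (sym ([]=⇒lookup i∈S)) (lookup-map i taken ι)
  ... | suc j | _ = j , refl

  weightedZeroSum : ∀ m (gs : Fin m → Elem (suc n)) →
    suc (s ℕ.* (p ℕ.^ k ℕ.∸ 1) ℕ.+ dStar p (suc n) ks) ℕ.≤ m ℕ.* s →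
    Σ (Subset m) λ S → 1 ℕ.≤ ∣ S ∣ × p ℕ.^ k ℕ∣.∣ ∣ S ∣ ×
      Σ (Fin m → ℕ) λ w → (∀ i → i ∈ S → Σ (Fin s) λ j → w i ≡ a j) × IsZeroG p (suc n) ks (wsum (suc n) m S w gs)
  weightedZeroSum m gs long with nontrivialChoice m gs (subst (λ b → suc b ℕ.≤ m ℕ.* s) (sym budget≡) long)
  ... | ι , nonempty , on =
    selected ι , nonempty , subst (q zero ℕ∣.∣_) (lookup-endpoint-zero ι gs origin) (on zero) ,
    weightsOf ι , selected⇒node ι ,
    λ t → subst (q (suc t) ℕ∣.∣_)
                (trans (lookup-endpoint-suc ι gs origin t)
                       (cong (ℕ._+ wsum (suc n) m (selected ι) (weightsOf ι) gs t) (lookup-replicate t 0)))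
                (on (suc t))

open import Defs
open import Data.Nat using (ℕ; zero; suc; _+_; _*_; _∸_; _^_; _≤_; _<_; _≥_; s≤s)
open import Data.Nat.Divisibility using (_∣_; divides)
open import Data.Nat.DivMod using (_%_; m≡m%n+[m/n]*n; m%n<n; m*n/n≡m; /-monoˡ-≤)
import Data.Nat.Properties as ℕₚ
open import Data.Nat.Primality using (Prime; prime⇒nonZero)
open import Data.Bool using (true; false; if_then_else_)
open import Data.Empty using (⊥-elim)
open import Data.Fin using (Fin; fromℕ; zero; suc; _↑ˡ_)
import Data.Fin as F
open import Data.Fin.Subset using (Subset; ∣_∣)
import Data.Fin.Subset as Subset
open import Data.Fin.Subset.Properties using (∣p∣≤n)
open import Data.List using (List; _∷_; length; lookup)
open import Data.List.Membership.Propositional using (_∈_)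
open import Data.List.Membership.Propositional.Properties using (∈-lookup)
import Data.List.Relation.Unary.All as All
open import Data.List.Relation.Unary.AllPairs using (_∷_)
open import Data.List.Relation.Unary.Unique.Propositional using (Unique)
import Data.Integer.Divisibility.Signed as ℤ∣
open import Data.Product using (Σ; _×_; _,_; proj₁; proj₂)
open import Data.Vec using ([]; _∷_; _++_; replicate; here; there)
open import Data.Vec.Properties using (lookup-replicate; []=⇒lookup)
open import Function using (_∘_)
open import Relation.Binary.PropositionalEquality
open import Relation.Nullary using (¬_)

ceilDiv-≥ : ∀ x s → 1 ≤ s → x ≤ ceilDiv x s * s
ceilDiv-≥ x (suc b) _ = ℕₚ.+-cancelʳ-≤ b x _ (begin
  x + b                                        ≡⟨ m≡m%n+[m/n]*n (x + b) (suc b) ⟩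
  (x + b) % suc b + ceilDiv x (suc b) * suc b  ≤⟨ ℕₚ.+-monoˡ-≤ _ (ℕₚ.≤-pred (m%n<n (x + b) (suc b))) ⟩
  b + ceilDiv x (suc b) * suc b                ≡⟨ ℕₚ.+-comm b _ ⟩
  ceilDiv x (suc b) * suc b + b                ∎)
  where open ℕₚ.≤-Reasoning

ceilDiv-≤ : ∀ x s e → 1 ≤ s → x + (s ∸ 1) ≤ e * s → ceilDiv x s ≤ e
ceilDiv-≤ x (suc b) e _ x+b≤es = subst (ceilDiv x (suc b) ≤_) (m*n/n≡m e (suc b)) (/-monoˡ-≤ (suc b) x+b≤es)

∣⇒≡ : ∀ {x e l} → 1 ≤ x → x ≤ l → l < e + e → e ∣ x → x ≡ e
∣⇒≡ 1≤x x≤l l<2e (divides zero          x≡0)    = ⊥-elim (ℕₚ.<⇒≱ 1≤x (ℕₚ.≤-reflexive x≡0))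
∣⇒≡ 1≤x x≤l l<2e (divides (suc zero)    x≡1·e)  = trans x≡1·e (ℕₚ.+-identityʳ _)
∣⇒≡ {x} {e} 1≤x x≤l l<2e (divides (suc (suc j)) x≡[2+j]e) = ⊥-elim (ℕₚ.<⇒≱ l<2e (begin
  e + e                   ≤⟨ ℕₚ.+-monoʳ-≤ e (ℕₚ.m≤m+n e (j * e)) ⟩
  suc (suc j) * e         ≡⟨ x≡[2+j]e ⟨
  x                       ≤⟨ x≤l ⟩
  _                       ∎))
  where open ℕₚ.≤-Reasoning

lookup-≢ : ∀ (xs : List ℕ) → Unique xs → ∀ i j → i ≢ j → lookup xs i ≢ lookup xs j
lookup-≢ (x ∷ xs) (x∉xs ∷ unique) zero    zero    i≢j = ⊥-elim (i≢j refl)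
lookup-≢ (x ∷ xs) (x∉xs ∷ unique) zero    (suc j) i≢j = All.lookup x∉xs (∈-lookup j)
lookup-≢ (x ∷ xs) (x∉xs ∷ unique) (suc i) zero    i≢j = All.lookup x∉xs (∈-lookup i) ∘ sym
lookup-≢ (x ∷ xs) (x∉xs ∷ unique) (suc i) (suc j) i≢j = lookup-≢ xs unique i j (i≢j ∘ cong suc)

∣S++∅∣≡∣S∣ : ∀ {l} o (S : Subset l) → ∣ S ++ replicate o false ∣ ≡ ∣ S ∣
∣S++∅∣≡∣S∣ {zero}  zero    []      = refl
∣S++∅∣≡∣S∣ {zero}  (suc o) []      = ∣S++∅∣≡∣S∣ o []
∣S++∅∣≡∣S∣ {suc l} o (false ∷ S) = ∣S++∅∣≡∣S∣ o S
∣S++∅∣≡∣S∣ {suc l} o (true ∷ S)  = cong suc (∣S++∅∣≡∣S∣ o S)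

AWeightedZeroSum-++∅ : ∀ {p r ks A l} o (c : Fin (l + o) → Elem r) (S : Subset l) →
                       AWeightedZeroSum p r ks A l (c ∘ (_↑ˡ o)) S →
                       AWeightedZeroSum p r ks A (l + o) c (S ++ replicate o false)
AWeightedZeroSum-++∅ {p} {r} {ks} {A} {l} o c S (w , w∈A , zero-sum) =
  padded l w , padded∈A l S w w∈A , λ t → subst (p ^ ks t ∣_) (sym (wsum-padded l S w c t)) (zero-sum t)
  where
  padded : ∀ l → (Fin l → ℕ) → Fin (l + o) → ℕ
  padded zero    w i       = 0
  padded (suc l) w zero    = w zero
  padded (suc l) w (suc i) = padded l (w ∘ suc) i
  wsum-padded : ∀ l (S : Subset l) w (c : Fin (l + o) → Elem r) t →
                wsum r (l + o) (S ++ replicate o false) (padded l w) c t ≡ wsum r l S w (c ∘ (_↑ˡ o)) t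
  wsum-padded zero    []      w c t = NatSums.∑-zero o _ λ i → cong (λ b → if b then 0 * c i t else 0) (lookup-replicate i false)
  wsum-padded (suc l) (b ∷ S) w c t = cong (_ +_) (wsum-padded l S (w ∘ suc) (c ∘ suc) t)
  padded∈A : ∀ l (S : Subset l) w → (∀ i → i Subset.∈ S → w i ∈ A) →
             ∀ i → i Subset.∈ (S ++ replicate o false) → padded l w i ∈ A
  padded∈A zero    []      w w∈A i       i∈∅ with trans (sym ([]=⇒lookup i∈∅)) (lookup-replicate i false)
  ... | ()
  padded∈A (suc l) (b ∷ S) w w∈A zero    here     = w∈A zero here
  padded∈A (suc l) (b ∷ S) w w∈A (suc i) (there i∈S) =
    padded∈A l S (w ∘ suc) (λ j j∈S → w∈A (suc j) (there j∈S)) i i∈S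

d+1+[s∸1]≤e*s : ∀ d s e → 1 ≤ s → 1 ≤ e → d ≤ s * (e ∸ 1) → d + 1 + (s ∸ 1) ≤ e * s
d+1+[s∸1]≤e*s d (suc b) (suc e) _ _ d≤[1+b]e = begin
  d + 1 + b             ≡⟨ ℕₚ.+-assoc d 1 b ⟩
  d + suc b             ≤⟨ ℕₚ.+-monoˡ-≤ (suc b) d≤[1+b]e ⟩
  suc b * e + suc b     ≡⟨ ℕₚ.+-comm (suc b * e) (suc b) ⟩
  suc b + suc b * e     ≡⟨ cong (suc b +_) (ℕₚ.*-comm (suc b) e) ⟩
  suc e * suc b         ∎
  where open ℕₚ.≤-Reasoning

e∸1+c<e+e : ∀ {e c} → 1 ≤ e → c ≤ e → e ∸ 1 + c < e + e
e∸1+c<e+e {suc e} _ c≤e = s≤s (ℕₚ.+-monoʳ-≤ e c≤e)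

module _ {p} (prime : Prime p) (n : ℕ) (ks : Fin (suc n) → ℕ) (A : List ℕ) (unique : Unique A) (A≢[] : 1 ≤ length A)
         (A<exp : ∀ a → a ∈ A → a < p ^ ks (fromℕ n))
         (incongruent : ∀ a b → a ∈ A → b ∈ A → a ≢ b → ¬ (a ≡ b [mod p ])) where

  private
    s d* e : ℕ
    s = length A
    d* = dStar p (suc n) ks
    e = p ^ ks (fromℕ n)

    distinct : Weights.DistinctMod prime (lookup A)
    distinct i j i≢j p∣ = incongruent (lookup A i) (lookup A j) (∈-lookup i) (∈-lookup j) (lookup-≢ A unique i j i≢j)
                                      (ℤ∣.∣⇒∣ᵤ p∣)

  divisibleLengthZeroSum : ∀ k m → p ^ k ∸ 1 + ceilDiv (d* + 1) s ≤ m → (c : Fin m → Elem (suc n)) →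
                           Σ (Subset m) λ S → 1 ≤ ∣ S ∣ × p ^ k ∣ ∣ S ∣ × AWeightedZeroSum p (suc n) ks A m c S
  divisibleLengthZeroSum k m long c =
    let S , S≢∅ , p^k∣∣S∣ , w , w∈a , zero-sum = found
    in S , S≢∅ , p^k∣∣S∣ , w , (λ i i∈S → subst (_∈ A) (sym (proj₂ (w∈a i i∈S))) (∈-lookup (proj₁ (w∈a i i∈S))))
     , zero-sum
    where
    long′ : suc (s * (p ^ k ∸ 1) + d*) ≤ m * s
    long′ = begin
      suc (s * (p ^ k ∸ 1) + d*)                 ≡⟨ trans (cong (s * (p ^ k ∸ 1) +_) (ℕₚ.+-comm d* 1)) (ℕₚ.+-suc _ d*) ⟨
      s * (p ^ k ∸ 1) + (d* + 1)                 ≤⟨ ℕₚ.+-mono-≤ (ℕₚ.≤-reflexive (ℕₚ.*-comm s _)) (ceilDiv-≥ (d* + 1) s A≢[]) ⟩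
      (p ^ k ∸ 1) * s + ceilDiv (d* + 1) s * s   ≡⟨ ℕₚ.*-distribʳ-+ s (p ^ k ∸ 1) _ ⟨
      (p ^ k ∸ 1 + ceilDiv (d* + 1) s) * s       ≤⟨ ℕₚ.*-monoˡ-≤ s long ⟩
      m * s                                      ∎
      where open ℕₚ.≤-Reasoning
    found : Σ (Subset m) λ S → 1 ≤ ∣ S ∣ × p ^ k ∣ ∣ S ∣ ×
              Σ (Fin m → ℕ) λ w → (∀ i → i Subset.∈ S → Σ (Fin s) λ j → w i ≡ lookup A j)
                                × IsZeroG p (suc n) ks (wsum (suc n) m S w c)
    found = WeightedZeroSums.weightedZeroSum prime n ks k (lookup A) e (λ i → A<exp _ (∈-lookup i)) distinct m c long′

  sA≤-bound : s * (e ∸ 1) ≥ d* → sA≤ p (suc n) ks A e (e ∸ 1 + ceilDiv (d* + 1) s)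
  sA≤-bound d*≤s[e-1] m l≤m with ℕₚ.m≤n⇒∃[o]m+o≡n l≤m
  ... | o , refl = λ c →
    let S , S≢∅ , e∣∣S∣ , zero-sum = divisibleLengthZeroSum (ks (fromℕ n)) l ℕₚ.≤-refl (c ∘ (_↑ˡ o))
    in S ++ replicate o false , trans (∣S++∅∣≡∣S∣ o S) (∣⇒≡ S≢∅ (∣p∣≤n S) l<2e e∣∣S∣)
     , AWeightedZeroSum-++∅ {p} {suc n} {ks} {A} o c S zero-sum
    where
    l : ℕ
    l = e ∸ 1 + ceilDiv (d* + 1) s
    1≤e : 1 ≤ e
    1≤e = ℕₚ.m^n>0 p {{prime⇒nonZero prime}} (ks (fromℕ n))
    ceil≤e : ceilDiv (d* + 1) s ≤ e
    ceil≤e = ceilDiv-≤ (d* + 1) s e A≢[] (d+1+[s∸1]≤e*s d* s e A≢[] 1≤e d*≤s[e-1])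
    l<2e : l < e + e
    l<2e = e∸1+c<e+e 1≤e ceil≤e

theorem1p1 :
    (p : ℕ) → Prime p →
    (n : ℕ) → (ks : Fin (suc n) → ℕ) →
    ((t : Fin (suc n)) → 1 ≤ ks t) →
    ((i j : Fin (suc n)) → i F.≤ j → ks i ≤ ks j) →
    (A : List ℕ) → Unique A → 1 ≤ length A →
    ((a : ℕ) → a ∈ A → 1 ≤ a × a < p ^ ks (fromℕ n)) →
    ((a : ℕ) → a ∈ A → ¬ (p ∣ a)) →
    ((a b : ℕ) → a ∈ A → b ∈ A → a ≢ b → ¬ (a ≡ b [mod p ])) →
    ((k : ℕ) → 1 ≤ k → (m : ℕ) →
       p ^ k ∸ 1 + ceilDiv (dStar p (suc n) ks + 1) (length A) ≤ m →
       (c : Fin m → Elem (suc n)) →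
       Σ (Subset m) λ S → 1 ≤ ∣ S ∣ × p ^ k ∣ ∣ S ∣
                          × AWeightedZeroSum p (suc n) ks A m c S)
    × (length A * (p ^ ks (fromℕ n) ∸ 1) ≥ dStar p (suc n) ks →
       sA≤ p (suc n) ks A (p ^ ks (fromℕ n))
           (p ^ ks (fromℕ n) ∸ 1 + ceilDiv (dStar p (suc n) ks + 1) (length A)))
theorem1p1 p p-prime n ks _ _ A unique A≢[] bounds _ incongruent =
  (λ k _ → divisibleLengthZeroSum p-prime n ks A unique A≢[] A<exp incongruent k) ,
  sA≤-bound p-prime n ks A unique A≢[] A<exp incongruent
  where
  A<exp : ∀ a → a ∈ A → a < p ^ ks (fromℕ n)
  A<exp a a∈A = proj₂ (bounds a a∈A)
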